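{- Let $\mathcal C\le\mathbb F_q^{n\times m}$ be a rank-metric code with associated $(q,m)$-polymatroid $P_{\mathcal C}$. For all integers $1\le r\le\dim\mathcal C$, $$g\Bigl(\bigl(P_{\mathcal C}^{(r-1)}\bigr)^\ast\Bigr)=d^{(r)}_{\mathcal C}.$$
   Context: $q$ prime power, $E=\mathbb F_q^n$, $\mathcal L(E)$ its subspaces, $J^\perp$ orthogonal complement for the standard dot product. A rank-metric code is an $\mathbb F_q$-subspace $\mathcal C\le\mathbb F_q^{n\times m}$; $\mathrm{supp}(M)$ is the column space of $M$; for a subcode $\mathcal D$, $\mathrm{Supp}(\mathcal D)=\sum_{M\in\mathcal D}\mathrm{supp}(M)$. $\mathcal C(J)=\{M\in\mathcal C\mid\mathrm{supp}(M)\subseteq J\}$, $\rho_{\mathcal C}(J)=\dim\mathcal C-\dim\mathcal C(J^\perp)$, $P_{\mathcal C}=(E,\rho_{\mathcal C})$, a $(q,m)$-polymatroid (i.e. $\rho:\mathcal L(E)\to\mathbb Z_{\ge 0}$ with $0\le\rho(A)\le m\dim A$, monotone, submodular). For a $(q,m)$-polymatroid $P=(E,\rho)$: the truncation $P^{(t)}=(E,\rho^{(t)})$, $\rho^{(t)}(J)=\min\{\rho(J),\rho(E)-t\}$ ($0\le t\le\rho(E)$); the dual $P^\ast=(E,\rho^\ast)$, $\rho^\ast(J)=\rho(J^\perp)+m\dim J-\rho(E)$; a subspace $I$ is independent if $\rho(I)=m\dim I$, a circuit is a dependent subspace all of whose proper subspaces are independent; the girth $g(P)$ is the minimum dimension of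 a circuit ($\infty$ if none). The $r$-th generalized minimum rank-weight is $d^{(r)}_{\mathcal C}=\min\{\dim\mathrm{Supp}(\mathcal D)\mid\mathcal D\le\mathcal C,\dim\mathcal D=r\}$ ($\infty$ if no such $\mathcal D$). -}

module Defs where

open import Data.Nat using (ℕ; zero; suc; _+_; _*_; _∸_; _⊓_; _≤_)
open import Data.Bool using (Bool; true; false; not; _∧_; _∨_; if_then_else_)
open import Data.List using (List; []; _∷_; [_]; map; concatMap; filterᵇ; length; foldr; zipWith)
open import Data.Bool.ListAction using (any; all)
open import Data.List.Membership.Propositional using (_∈_)
open import Data.List.Relation.Unary.Unique.Propositional using (Unique)
open import Data.Vec using (Vec; []; _∷_; toList; lookup; tabulate; replicate)
import Data.Vec as V
open import Data.Vec.Properties using (≡-dec)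
open import Data.Fin using (Fin)
open import Data.Product using (Σ; _×_; _,_; ∃)
open import Relation.Nullary using (¬_; Dec; yes; no)
open import Relation.Nullary.Decidable using (⌊_⌋)
open import Relation.Binary.PropositionalEquality using (_≡_; _≢_)
open import Relation.Binary.Definitions using (DecidableEquality)
open import Algebra.Structures using (IsCommutativeRing)

-- Finite fields (every finite field is some F_q with q a prime power,
-- and q is the number of its elements, length elems).

record FiniteField : Set₁ where
  field
    Carrier  : Set
    _+F_     : Carrier → Carrier → Carrier
    _*F_     : Carrier → Carrier → Carrier
    -F_      : Carrier → Carrier
    0F 1F    : Carrier
    isCommutativeRing : IsCommutativeRing _≡_ _+F_ _*F_ -F_ 0F 1F
    0≢1      : 0F ≢ 1F
    inverse  : ∀ x → x ≢ 0F → ∃ λ y → x *F y ≡ 1F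
    _≟F_     : DecidableEquality Carrier
    elems    : List Carrier
    complete : ∀ x → x ∈ elems
    unique   : Unique elems

vecsOf : {A : Set} → List A → (n : ℕ) → List (Vec A n)
vecsOf xs zero    = [ [] ]
vecsOf xs (suc n) = concatMap (λ a → map (a ∷_) (vecsOf xs n)) xs

-- least i in {s, s+1, ..., s+fuel-1} with f i = true (s+fuel if none)
search : (ℕ → Bool) → ℕ → ℕ → ℕ
search f zero     i = i
search f (suc k)  i = if f i then i else search f k (suc i)

module Over (F : FiniteField) where
  open FiniteField F public

  -- Linear algebra in a finite F-vector space X (given with an
  -- enumeration allX of all its elements).  Subsets are Bool predicates.
  module FinVS (X : Set) (_⊕_ : X → X → X) (_·_ : Carrier → X → X)
               (𝟎 : X) (_≟X_ : DecidableEquality X) (allX : List X) where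

    Pred : Set
    Pred = X → Bool

    lincomb : List Carrier → List X → X
    lincomb cs gs = foldr _⊕_ 𝟎 (zipWith _·_ cs gs)

    inSpan : List X → Pred
    inSpan gs v = any (λ cs → ⌊ lincomb (toList cs) gs ≟X v ⌋) (vecsOf elems (length gs))

    _⊆ᵇ_ : Pred → Pred → Bool
    p ⊆ᵇ q = all (λ v → not (p v) ∨ q v) allX

    spans : Pred → List X → Bool
    spans p gs = all p gs ∧ (p ⊆ᵇ inSpan gs)

    hasSpanningOfSize : Pred → ℕ → Bool
    hasSpanningOfSize p d = any (λ gs → spans p (toList gs)) (vecsOf (filterᵇ p allX) d)

    -- dimension = least cardinality of a spanning family of p
    dim : Pred → ℕ
    dim p = search (hasSpanningOfSize p) (suc (length allX)) 0

    IsSubspace : Pred → Set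
    IsSubspace p = (p 𝟎 ≡ true)
                 × (∀ x y → p x ≡ true → p y ≡ true → p (x ⊕ y) ≡ true)
                 × (∀ a x → p x ≡ true → p (a · x) ≡ true)

    _⊆_ : Pred → Pred → Set
    p ⊆ q = ∀ v → p v ≡ true → q v ≡ true

    _⊂_ : Pred → Pred → Set
    p ⊂ q = (p ⊆ q) × (∃ λ v → (q v ≡ true) × (p v ≡ false))

  Vect : ℕ → Set
  Vect n = Vec Carrier n

  module E (n : ℕ) = FinVS (Vect n) (V.zipWith _+F_) (λ a → V.map (a *F_))
                           (replicate n 0F) (≡-dec _≟F_) (vecsOf elems n)

  -- n × m matrices (n rows, m columns)
  Mat : ℕ → ℕ → Set
  Mat n m = Vec (Vec Carrier m) n

  module M (n m : ℕ) = FinVS (Mat n m) (V.zipWith (V.zipWith _+F_))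
                             (λ a → V.map (V.map (a *F_)))
                             (replicate n (replicate m 0F))
                             (≡-dec (≡-dec _≟F_)) (vecsOf (vecsOf elems m) n)

  dot : ∀ {n} → Vect n → Vect n → Carrier
  dot u v = foldr _+F_ 0F (toList (V.zipWith _*F_ u v))

  perp : ∀ {n} → E.Pred n → E.Pred n
  perp {n} J v = all (λ w → not (J w) ∨ ⌊ dot v w ≟F 0F ⌋) (vecsOf elems n)

  full : ∀ {n} → E.Pred n
  full _ = true

  columns : ∀ {n m} → Mat n m → List (Vect n)
  columns {m = m} A = toList (tabulate (λ (j : Fin m) → V.map (λ row → lookup row j) A))

  supp : ∀ {n m} → Mat n m → E.Pred n
  supp {n} A = E.inSpan n (columns A)

  Supp : ∀ {n m} → M.Pred n m → E.Pred n
  Supp {n} {m} D = E.inSpan n (concatMap columns (filterᵇ D (vecsOf (vecsOf elems m) n)))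

  restrict : ∀ {n m} → M.Pred n m → E.Pred n → M.Pred n m
  restrict {n} C J A = C A ∧ E._⊆ᵇ_ n (supp A) J

  -- rank functions on L(E) (defined on all predicates, used on subspaces)
  RankFn : ℕ → Set
  RankFn n = E.Pred n → ℕ

  ρC : ∀ {n m} → M.Pred n m → RankFn n
  ρC {n} {m} C J = M.dim n m C ∸ M.dim n m (restrict C (perp J))

  trunc : ∀ {n} → ℕ → RankFn n → RankFn n
  trunc t ρ J = ρ J ⊓ (ρ full ∸ t)

  dual : ∀ {n} → (m : ℕ) → RankFn n → RankFn n
  dual {n} m ρ J = (ρ (perp J) + m * E.dim n J) ∸ ρ full

  Independent : ∀ {n} → ℕ → RankFn n → E.Pred n → Set
  Independent {n} m ρ I = ρ I ≡ m * E.dim n I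

  IsCircuit : ∀ {n} → ℕ → RankFn n → E.Pred n → Set
  IsCircuit {n} m ρ Z = E.IsSubspace n Z × ¬ Independent m ρ Z
                      × (∀ I → E.IsSubspace n I → E._⊂_ n I Z → Independent m ρ I)

  IsGirth : ∀ {n} → ℕ → RankFn n → ℕ → Set
  IsGirth {n} m ρ k = (∃ λ Z → IsCircuit m ρ Z × E.dim n Z ≡ k)
                    × (∀ Z → IsCircuit m ρ Z → k ≤ E.dim n Z)

  IsGenRankWeight : ∀ {n m} → M.Pred n m → ℕ → ℕ → Set
  IsGenRankWeight {n} {m} C r k =
      (∃ λ D → M.IsSubspace n m D × M._⊆_ n m D C × M.dim n m D ≡ r × E.dim n (Supp D) ≡ k)
    × (∀ D → M.IsSubspace n m D → M._⊆_ n m D C → M.dim n m D ≡ r → k ≤ E.dim n (Supp D))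

-- Write c(J) = dim C(J) and k = dim C. Because J⊥⊥ = J and C({0}) = 0, the rank function of the dual of the
-- (r−1)-truncation of P_C is ρ(Z) = min(k − c(Z), k − r + 1) + m·dim Z − (k − r + 1), so a subspace Z is
-- dependent exactly when c(Z) ≥ r. Hence a subspace Z of least dimension with c(Z) ≥ r is a circuit of least
-- dimension, and its dimension is the girth. The same Z realises d_C^(r): an r-dimensional subcode D lies in
-- C(Supp D), so c(Supp D) ≥ r and dim Supp D ≥ dim Z, while any r-dimensional subcode of C(Z) is supported in Z.
-- The identity J⊥⊥ = J rests on dim J⊥ + dim J = n; the inequality ≤ holds because, for an independent list b,
-- the map v ↦ (v·bᵢ)ᵢ is onto, its image having trivial orthogonal complement.

module Submission where

open import Defs
open import Algebra.Bundles using (CommutativeRing)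
import Algebra.Properties.CommutativeSemigroup as CommutativeSemigroupProperties
import Algebra.Properties.Ring as RingProperties
open import Data.Bool using (Bool; true; false; not; _∧_; _∨_)
open import Data.Bool.ListAction using (any; all)
open import Data.Bool.Properties using (∧-conicalˡ; ∧-conicalʳ; T-≡)
open import Data.Empty using (⊥; ⊥-elim)
open import Data.Fin using (Fin; zero; suc)
open import Data.Fin.Properties using (¬Fin0)
open import Data.List using (List; []; _∷_; _++_; map; length; concatMap; filterᵇ; drop)
open import Data.List.Extrema.Nat using (argmin; argmin-all; f[argmin]≤f[xs])
open import Data.List.Membership.Propositional using (_∈_; find)
open import Data.List.Membership.Propositional.Properties
  using (∈-map⁺; ∈-concatMap⁺; ∈-concatMap⁻; ∈-filter⁺; ∈-filter⁻; ∈-tabulate⁺; ∈-tabulate⁻)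
import Data.List.Properties as List
open import Data.List.Relation.Unary.All as All using (All; []; _∷_)
open import Data.List.Relation.Unary.All.Properties using (++⁺; drop⁺)
open import Data.List.Relation.Unary.Any as Any using (here; there)
open import Data.Nat
  using (ℕ; zero; suc; _+_; _*_; _∸_; _⊓_; _≤_; _<_; _≟_; _≤?_; _<?_; z≤n; s≤s; s<s⁻¹; NonZero; >-nonZero)
open import Data.Nat.Properties
open import Data.Product using (∃; _×_; _,_; proj₁; proj₂)
open import Data.Sum using (_⊎_; inj₁; inj₂)
open import Data.Vec as Vec using (Vec; []; _∷_; toList; replicate; lookup; tabulate)
import Data.Vec.Properties as Vec
import Data.Vec.Relation.Unary.All as VecAll
open import Data.Vec.Relation.Unary.All.Properties using (fromList⁺)
open import Function using (_∘_; Equivalence)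
open import Relation.Binary.Definitions using (DecidableEquality)
open import Relation.Binary.PropositionalEquality
open import Relation.Nullary using (¬_; Dec; yes; no; T?; contradiction)
open import Relation.Nullary.Decidable using (⌊_⌋)

⇔true⇒≡ : ∀ {a b : Bool} → (a ≡ true → b ≡ true) → (b ≡ true → a ≡ true) → a ≡ b
⇔true⇒≡ {true}  {true}  _ _ = refl
⇔true⇒≡ {true}  {false} f _ = sym (f refl)
⇔true⇒≡ {false} {true}  _ g = g refl
⇔true⇒≡ {false} {false} _ _ = refl

≡true⇒≢false : ∀ {a} → a ≡ true → a ≢ false
≡true⇒≢false refl ()

∧-true : ∀ {a b} → a ≡ true → b ≡ true → a ∧ b ≡ true
∧-true refl refl = refl

⌊⌋-true⁺ : ∀ {A : Set} (a? : Dec A) → A → ⌊ a? ⌋ ≡ true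
⌊⌋-true⁺ (yes _) _ = refl
⌊⌋-true⁺ (no ¬a) a = contradiction a ¬a

⌊⌋-true⁻ : ∀ {A : Set} (a? : Dec A) → ⌊ a? ⌋ ≡ true → A
⌊⌋-true⁻ (yes a) _ = a

⌊⌋-false⁺ : ∀ {A : Set} (a? : Dec A) → ¬ A → ⌊ a? ⌋ ≡ false
⌊⌋-false⁺ (yes a) ¬a = contradiction a ¬a
⌊⌋-false⁺ (no _)  _  = refl

module _ {A : Set} where

  any-true⁺ : ∀ (p : A → Bool) {xs x} → x ∈ xs → p x ≡ true → any p xs ≡ true
  any-true⁺ p {y ∷ _} (here refl) px rewrite px = refl
  any-true⁺ p {y ∷ _} (there x∈) px with p y
  ... | true  = refl
  ... | false = any-true⁺ p x∈ px

  any-true⁻ : ∀ (p : A → Bool) xs → any p xs ≡ true → ∃ λ x → x ∈ xs × p x ≡ true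
  any-true⁻ p (x ∷ xs) e with p x in px
  ... | true  = x , here refl , px
  ... | false = let y , y∈ , py = any-true⁻ p xs e in y , there y∈ , py

  all-true⁺ : ∀ (p : A → Bool) xs → (∀ x → x ∈ xs → p x ≡ true) → all p xs ≡ true
  all-true⁺ p []       _ = refl
  all-true⁺ p (x ∷ xs) h = ∧-true (h x (here refl)) (all-true⁺ p xs (λ y → h y ∘ there))

  all-true⁻ : ∀ (p : A → Bool) {xs} → all p xs ≡ true → ∀ x → x ∈ xs → p x ≡ true
  all-true⁻ p {y ∷ _} e x (here refl) = ∧-conicalˡ _ _ e
  all-true⁻ p {y ∷ _} e x (there x∈) = all-true⁻ p (∧-conicalʳ _ _ e) x x∈

  all-cong : ∀ {p q : A → Bool} → (∀ x → p x ≡ q x) → ∀ xs → all p xs ≡ all q xs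
  all-cong h []       = refl
  all-cong h (x ∷ xs) = cong₂ _∧_ (h x) (all-cong h xs)

  ∈-filterᵇ⁺ : ∀ (p : A → Bool) {xs x} → x ∈ xs → p x ≡ true → x ∈ filterᵇ p xs
  ∈-filterᵇ⁺ p x∈ px = ∈-filter⁺ (T? ∘ p) x∈ (Equivalence.from T-≡ px)

  ∈-filterᵇ⁻ : ∀ (p : A → Bool) xs {x} → x ∈ filterᵇ p xs → p x ≡ true
  ∈-filterᵇ⁻ p xs x∈ = Equivalence.to T-≡ (proj₂ (∈-filter⁻ (T? ∘ p) {xs = xs} x∈))

  ∈-vecsOf : ∀ {xs : List A} {n} {v : Vec A n} → VecAll.All (_∈ xs) v → v ∈ vecsOf xs n
  ∈-vecsOf VecAll.[] = here refl
  ∈-vecsOf {xs} {suc n} (a∈ VecAll.∷ v∈) =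
    ∈-concatMap⁺ (λ a → map (a ∷_) (vecsOf xs n)) (Any.map (λ { refl → ∈-map⁺ (_ ∷_) (∈-vecsOf v∈) }) a∈)

  listsOf : List A → ℕ → List (List A)
  listsOf xs zero    = [] ∷ []
  listsOf xs (suc k) = [] ∷ concatMap (λ a → map (a ∷_) (listsOf xs k)) xs

  ∈-listsOf : ∀ {xs} → (∀ x → x ∈ xs) → ∀ k (l : List A) → length l ≤ k → l ∈ listsOf xs k
  ∈-listsOf all∈ zero    []      _         = here refl
  ∈-listsOf all∈ (suc k) []      _         = here refl
  ∈-listsOf {xs} all∈ (suc k) (a ∷ l) (s≤s l≤k) = there
    (∈-concatMap⁺ (λ a → map (a ∷_) (listsOf xs k))
      (Any.map (λ { refl → ∈-map⁺ (a ∷_) (∈-listsOf all∈ k l l≤k) }) (all∈ a)))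

length-reduce : ∀ {A B : Set} {P : A → Set} (f : ∀ {x} → P x → B) {xs} (ps : All P xs) →
                length (All.reduce f ps) ≡ length xs
length-reduce f []       = refl
length-reduce f (p ∷ ps) = cong suc (length-reduce f ps)

toList∘tabulate : ∀ {A : Set} {k} (f : Fin k → A) → toList (tabulate f) ≡ Data.List.tabulate f
toList∘tabulate {k = zero}  f = refl
toList∘tabulate {k = suc k} f = cong (f zero ∷_) (toList∘tabulate (f ∘ suc))

search-hit : ∀ f fuel s → search f fuel s ≡ s + fuel ⊎ f (search f fuel s) ≡ true
search-hit f zero       s = inj₁ (sym (+-identityʳ s))
search-hit f (suc fuel) s with f s in fs
... | true  = inj₂ fs
... | false with search-hit f fuel (suc s)
...   | inj₁ e = inj₁ (trans e (sym (+-suc s fuel)))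
...   | inj₂ e = inj₂ e

search-minimal : ∀ f fuel s i → s ≤ i → i < s + fuel → f i ≡ true → search f fuel s ≤ i
search-minimal f zero       s i s≤i i<s+0 _ = contradiction (subst (i <_) (+-identityʳ s) i<s+0) (≤⇒≯ s≤i)
search-minimal f (suc fuel) s i s≤i i<s+fuel fi with f s in fs
... | true  = s≤i
... | false with m≤n⇒m<n∨m≡n s≤i
...   | inj₂ refl = contradiction fs (≡true⇒≢false fi)
...   | inj₁ s<i  = search-minimal f fuel (suc s) i s<i (subst (i <_) (+-suc s fuel) i<s+fuel) fi

m≥n⇒m⊓n+o∸n≡o : ∀ {m n} o → n ≤ m → m ⊓ n + o ∸ n ≡ o
m≥n⇒m⊓n+o∸n≡o {n = n} o n≤m = trans (cong (λ x → x + o ∸ n) (m≥n⇒m⊓n≡n n≤m)) (m+n∸m≡n n o)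

m⊓n+o∸n≡o⇒n≤m : ∀ m n o → .{{NonZero o}} → m ⊓ n + o ∸ n ≡ o → n ≤ m
m⊓n+o∸n≡o⇒n≤m m n o e with n ≤? m
... | yes n≤m = n≤m
... | no  n≰m = contradiction e (<⇒≢ (m<n+o⇒m∸n<o (m ⊓ n + o) n (+-monoˡ-< o m⊓n<n)))
  where
  m⊓n<n : m ⊓ n < n
  m⊓n<n = subst (_< n) (sym (m≤n⇒m⊓n≡m (<⇒≤ (≰⇒> n≰m)))) (≰⇒> n≰m)

<⇒≤∸1 : ∀ {m n} → m < n → m ≤ n ∸ 1
<⇒≤∸1 (s≤s m≤n) = m≤n

≤∸1⇒< : ∀ {m n} → 1 ≤ n → m ≤ n ∸ 1 → m < n
≤∸1⇒< {n = suc n} _ m≤n = s≤s m≤n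

-- Linear algebra over a finite field

module LinearAlgebra (F : FiniteField) where
  open Over F public

  field-ring : CommutativeRing _ _
  field-ring = record { isCommutativeRing = isCommutativeRing }

  module R = CommutativeRing field-ring
  open RingProperties R.ring using (-‿distribˡ-*; -‿distribʳ-*; -‿+-comm; -0#≈0#)
  open CommutativeSemigroupProperties R.+-commutativeSemigroup using () renaming (interchange to +F-interchange)

  x+-[x*y]*c≡0 : ∀ x y c → c *F y ≡ 1F → x +F ((-F (x *F y)) *F c) ≡ 0F
  x+-[x*y]*c≡0 x y c cy≡1 = begin
    x +F ((-F (x *F y)) *F c)  ≡⟨ cong (x +F_) (sym (-‿distribˡ-* (x *F y) c)) ⟩
    x +F (-F ((x *F y) *F c))  ≡⟨ cong (λ t → x +F (-F t)) (R.*-assoc x y c) ⟩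
    x +F (-F (x *F (y *F c)))  ≡⟨ cong (λ t → x +F (-F (x *F t))) (trans (R.*-comm y c) cy≡1) ⟩
    x +F (-F (x *F 1F))        ≡⟨ cong (λ t → x +F (-F t)) (R.*-identityʳ x) ⟩
    x +F (-F x)                ≡⟨ R.-‿inverseʳ x ⟩
    0F                         ∎
    where open ≡-Reasoning

  -[x*y+z]≡x*-y+-z : ∀ x y z → -F ((x *F y) +F z) ≡ (x *F (-F y)) +F (-F z)
  -[x*y+z]≡x*-y+-z x y z = trans (sym (-‿+-comm (x *F y) z)) (cong (_+F (-F z)) (-‿distribʳ-* x y))

  record VectorSpaceLaws (X : Set) (_⊕_ : X → X → X) (_·_ : Carrier → X → X) (𝟎 : X) : Set where
    field
      ⊕-assoc     : ∀ x y z → (x ⊕ y) ⊕ z ≡ x ⊕ (y ⊕ z)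
      ⊕-comm      : ∀ x y → x ⊕ y ≡ y ⊕ x
      ⊕-identityˡ : ∀ x → 𝟎 ⊕ x ≡ x
      ·-distribˡ  : ∀ a x y → a · (x ⊕ y) ≡ (a · x) ⊕ (a · y)
      ·-distribʳ  : ∀ a b x → (a +F b) · x ≡ (a · x) ⊕ (b · x)
      ·-assoc     : ∀ a b x → (a *F b) · x ≡ a · (b · x)
      ·-identity  : ∀ x → 1F · x ≡ x
      ·-zeroˡ     : ∀ x → 0F · x ≡ 𝟎

  -- Only coefficients that meet a vector count: lincomb, built from zipWith, ignores the others.
  SomeNonzero : ∀ {A : Set} → List Carrier → List A → Set
  SomeNonzero []       _        = ⊥
  SomeNonzero (_ ∷ _)  []       = ⊥
  SomeNonzero (c ∷ cs) (_ ∷ gs) = c ≢ 0F ⊎ SomeNonzero cs gs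

  SomeNonzero-length : ∀ {A B : Set} cs {xs : List A} {ys : List B} →
                       length xs ≡ length ys → SomeNonzero cs xs → SomeNonzero cs ys
  SomeNonzero-length (c ∷ cs) {_ ∷ _}  {_ ∷ _}  _ (inj₁ c≢0) = inj₁ c≢0
  SomeNonzero-length (c ∷ cs) {_ ∷ xs} {_ ∷ ys} e (inj₂ nz)  = inj₂ (SomeNonzero-length cs (suc-injective e) nz)

  module VectorSpace (X : Set) (_⊕_ : X → X → X) (_·_ : Carrier → X → X) (𝟎 : X)
                     (_≟X_ : DecidableEquality X) (allX : List X)
                     (laws : VectorSpaceLaws X _⊕_ _·_ 𝟎) (∈-allX : ∀ x → x ∈ allX) where
    open FinVS X _⊕_ _·_ 𝟎 _≟X_ allX public
    open VectorSpaceLaws laws public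
    open ≡-Reasoning

    ⊕-identityʳ : ∀ x → x ⊕ 𝟎 ≡ x
    ⊕-identityʳ x = trans (⊕-comm x 𝟎) (⊕-identityˡ x)

    ·-zeroʳ : ∀ a → a · 𝟎 ≡ 𝟎
    ·-zeroʳ a = begin
      a · 𝟎           ≡⟨ cong (a ·_) (sym (·-zeroˡ 𝟎)) ⟩
      a · (0F · 𝟎)    ≡⟨ sym (·-assoc a 0F 𝟎) ⟩
      (a *F 0F) · 𝟎   ≡⟨ cong (_· 𝟎) (R.zeroʳ a) ⟩
      0F · 𝟎          ≡⟨ ·-zeroˡ 𝟎 ⟩
      𝟎               ∎

    ⊕-interchange : ∀ a b c d → (a ⊕ b) ⊕ (c ⊕ d) ≡ (a ⊕ c) ⊕ (b ⊕ d)
    ⊕-interchange a b c d = begin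
      (a ⊕ b) ⊕ (c ⊕ d)  ≡⟨ ⊕-assoc a b (c ⊕ d) ⟩
      a ⊕ (b ⊕ (c ⊕ d))  ≡⟨ cong (a ⊕_) (sym (⊕-assoc b c d)) ⟩
      a ⊕ ((b ⊕ c) ⊕ d)  ≡⟨ cong (λ t → a ⊕ (t ⊕ d)) (⊕-comm b c) ⟩
      a ⊕ ((c ⊕ b) ⊕ d)  ≡⟨ cong (a ⊕_) (⊕-assoc c b d) ⟩
      a ⊕ (c ⊕ (b ⊕ d))  ≡⟨ sym (⊕-assoc a c (b ⊕ d)) ⟩
      (a ⊕ c) ⊕ (b ⊕ d)  ∎

    a·x⊕-a·x≡𝟎 : ∀ a x → (a · x) ⊕ ((-F a) · x) ≡ 𝟎
    a·x⊕-a·x≡𝟎 a x = begin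
      (a · x) ⊕ ((-F a) · x)  ≡⟨ sym (·-distribʳ a (-F a) x) ⟩
      (a +F (-F a)) · x       ≡⟨ cong (_· x) (R.-‿inverseʳ a) ⟩
      0F · x                  ≡⟨ ·-zeroˡ x ⟩
      𝟎                       ∎

    lincomb-[]ʳ : ∀ cs → lincomb cs [] ≡ 𝟎
    lincomb-[]ʳ []      = refl
    lincomb-[]ʳ (_ ∷ _) = refl

    lead : List Carrier → Carrier
    lead []      = 0F
    lead (c ∷ _) = c

    rest : List Carrier → List Carrier
    rest []       = []
    rest (_ ∷ cs) = cs

    lincomb-∷ : ∀ g gs cs → lincomb cs (g ∷ gs) ≡ (lead cs · g) ⊕ lincomb (rest cs) gs
    lincomb-∷ g gs []      = sym (trans (cong (_⊕ 𝟎) (·-zeroˡ g)) (⊕-identityˡ 𝟎))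
    lincomb-∷ g gs (c ∷ cs) = refl

    _+ᶜ_ : List Carrier → List Carrier → List Carrier
    []       +ᶜ bs       = bs
    (a ∷ as) +ᶜ []       = a ∷ as
    (a ∷ as) +ᶜ (b ∷ bs) = (a +F b) ∷ (as +ᶜ bs)

    lincomb-+ᶜ : ∀ as bs gs → lincomb (as +ᶜ bs) gs ≡ lincomb as gs ⊕ lincomb bs gs
    lincomb-+ᶜ []       bs       gs       = sym (⊕-identityˡ _)
    lincomb-+ᶜ (a ∷ as) []       gs       = sym (⊕-identityʳ _)
    lincomb-+ᶜ (a ∷ as) (b ∷ bs) []       = sym (⊕-identityˡ 𝟎)
    lincomb-+ᶜ (a ∷ as) (b ∷ bs) (g ∷ gs) = begin
      ((a +F b) · g) ⊕ lincomb (as +ᶜ bs) gs              ≡⟨ cong₂ _⊕_ (·-distribʳ a b g) (lincomb-+ᶜ as bs gs) ⟩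
      ((a · g) ⊕ (b · g)) ⊕ (lincomb as gs ⊕ lincomb bs gs) ≡⟨ ⊕-interchange _ _ _ _ ⟩
      ((a · g) ⊕ lincomb as gs) ⊕ ((b · g) ⊕ lincomb bs gs) ∎

    lincomb-scale : ∀ c as gs → lincomb (map (c *F_) as) gs ≡ c · lincomb as gs
    lincomb-scale c []       gs       = sym (·-zeroʳ c)
    lincomb-scale c (a ∷ as) []       = sym (·-zeroʳ c)
    lincomb-scale c (a ∷ as) (g ∷ gs) = begin
      ((c *F a) · g) ⊕ lincomb (map (c *F_) as) gs  ≡⟨ cong₂ _⊕_ (·-assoc c a g) (lincomb-scale c as gs) ⟩
      (c · (a · g)) ⊕ (c · lincomb as gs)           ≡⟨ sym (·-distribˡ c _ _) ⟩
      c · ((a · g) ⊕ lincomb as gs)                 ∎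

    Span : List X → X → Set
    Span gs v = ∃ λ cs → lincomb cs gs ≡ v

    Span-𝟎 : ∀ gs → Span gs 𝟎
    Span-𝟎 gs = [] , refl

    Span-⊕ : ∀ gs {u v} → Span gs u → Span gs v → Span gs (u ⊕ v)
    Span-⊕ gs (as , refl) (bs , refl) = as +ᶜ bs , lincomb-+ᶜ as bs gs

    Span-· : ∀ gs a {v} → Span gs v → Span gs (a · v)
    Span-· gs a (cs , refl) = map (a *F_) cs , lincomb-scale a cs gs

    Span-∈ : ∀ gs {g} → g ∈ gs → Span gs g
    Span-∈ (h ∷ gs) (here refl) = 1F ∷ [] , trans (cong (_⊕ 𝟎) (·-identity h)) (⊕-identityʳ h)
    Span-∈ (h ∷ gs) (there g∈) =
      let cs , e = Span-∈ gs g∈ in 0F ∷ cs , trans (cong₂ _⊕_ (·-zeroˡ h) e) (⊕-identityˡ _)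

    Span-weaken : ∀ g gs {v} → Span gs v → Span (g ∷ gs) v
    Span-weaken g gs (cs , e) = 0F ∷ cs , trans (cong (_⊕ lincomb cs gs) (·-zeroˡ g)) (trans (⊕-identityˡ _) e)

    lincomb-closed : ∀ (P : X → Set) → P 𝟎 → (∀ {x y} → P x → P y → P (x ⊕ y)) →
                     (∀ a {x} → P x → P (a · x)) →
                     ∀ gs → (∀ g → g ∈ gs → P g) → ∀ cs → P (lincomb cs gs)
    lincomb-closed P P𝟎 P⊕ P· []       Pgs cs       = subst P (sym (lincomb-[]ʳ cs)) P𝟎
    lincomb-closed P P𝟎 P⊕ P· (g ∷ gs) Pgs []       = P𝟎
    lincomb-closed P P𝟎 P⊕ P· (g ∷ gs) Pgs (c ∷ cs) =
      P⊕ (P· c (Pgs g (here refl))) (lincomb-closed P P𝟎 P⊕ P· gs (λ x → Pgs x ∘ there) cs)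

    Span-trans : ∀ gs hs → (∀ g → g ∈ gs → Span hs g) → ∀ {v} → Span gs v → Span hs v
    Span-trans gs hs gs⊆ (cs , refl) = lincomb-closed (Span hs) (Span-𝟎 hs) (Span-⊕ hs) (Span-· hs) gs gs⊆ cs

    AllIn : Pred → List X → Set
    AllIn p gs = ∀ x → x ∈ gs → p x ≡ true

    Span⊆subspace : ∀ p → IsSubspace p → ∀ gs → AllIn p gs → ∀ {v} → Span gs v → p v ≡ true
    Span⊆subspace p (p𝟎 , p⊕ , p·) gs gs⊆p (cs , refl) =
      lincomb-closed (λ x → p x ≡ true) p𝟎 (p⊕ _ _) (λ a → p· a _) gs gs⊆p cs

    padTo : List Carrier → (gs : List X) → Vec Carrier (length gs)
    padTo cs       []       = []
    padTo []       (g ∷ gs) = 0F ∷ padTo [] gs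
    padTo (c ∷ cs) (g ∷ gs) = c ∷ padTo cs gs

    lincomb-padTo : ∀ cs gs → lincomb (toList (padTo cs gs)) gs ≡ lincomb cs gs
    lincomb-padTo cs       []       = sym (lincomb-[]ʳ cs)
    lincomb-padTo []       (g ∷ gs) = trans (cong₂ _⊕_ (·-zeroˡ g) (lincomb-padTo [] gs)) (⊕-identityˡ 𝟎)
    lincomb-padTo (c ∷ cs) (g ∷ gs) = cong ((c · g) ⊕_) (lincomb-padTo cs gs)

    inSpan⇒Span : ∀ gs v → inSpan gs v ≡ true → Span gs v
    inSpan⇒Span gs v e =
      let cs , _ , lc≟v = any-true⁻ _ (vecsOf elems (length gs)) e
      in toList cs , ⌊⌋-true⁻ (lincomb (toList cs) gs ≟X v) lc≟v

    Span⇒inSpan : ∀ gs v → Span gs v → inSpan gs v ≡ true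
    Span⇒inSpan gs v (cs , e) =
      any-true⁺ (λ cs → ⌊ lincomb (toList cs) gs ≟X v ⌋) (∈-vecsOf (VecAll.universal complete (padTo cs gs)))
        (⌊⌋-true⁺ (_ ≟X v) (trans (lincomb-padTo cs gs) e))

    inSpan-isSubspace : ∀ gs → IsSubspace (inSpan gs)
    inSpan-isSubspace gs =
        Span⇒inSpan gs 𝟎 (Span-𝟎 gs)
      , (λ x y x∈ y∈ → Span⇒inSpan gs _ (Span-⊕ gs (inSpan⇒Span gs x x∈) (inSpan⇒Span gs y y∈)))
      , (λ a x x∈ → Span⇒inSpan gs _ (Span-· gs a (inSpan⇒Span gs x x∈)))

    LinDependent : List X → Set
    LinDependent ws = ∃ λ cs → lincomb cs ws ≡ 𝟎 × SomeNonzero cs ws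

    LinIndependent : List X → Set
    LinIndependent ws = ¬ LinDependent ws

    insertAt : ℕ → List Carrier → Carrier → List Carrier
    insertAt zero    cs       s = s ∷ cs
    insertAt (suc i) []       s = 0F ∷ insertAt i [] s
    insertAt (suc i) (c ∷ cs) s = c ∷ insertAt i cs s

    lincomb-insertAt : ∀ pre cs s w ws →
                       lincomb (insertAt (length pre) cs s) (pre ++ w ∷ ws) ≡ lincomb cs (pre ++ ws) ⊕ (s · w)
    lincomb-insertAt []        cs       s w ws = ⊕-comm _ _
    lincomb-insertAt (x ∷ pre) []       s w ws = begin
      (0F · x) ⊕ lincomb (insertAt (length pre) [] s) (pre ++ w ∷ ws)
        ≡⟨ cong₂ _⊕_ (·-zeroˡ x) (lincomb-insertAt pre [] s w ws) ⟩
      𝟎 ⊕ (𝟎 ⊕ (s · w))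
        ≡⟨ ⊕-identityˡ _ ⟩
      𝟎 ⊕ (s · w)
        ∎
    lincomb-insertAt (x ∷ pre) (c ∷ cs) s w ws = begin
      (c · x) ⊕ lincomb (insertAt (length pre) cs s) (pre ++ w ∷ ws) ≡⟨ cong ((c · x) ⊕_) (lincomb-insertAt pre cs s w ws) ⟩
      (c · x) ⊕ (lincomb cs (pre ++ ws) ⊕ (s · w))                   ≡⟨ sym (⊕-assoc _ _ _) ⟩
      ((c · x) ⊕ lincomb cs (pre ++ ws)) ⊕ (s · w)                   ∎

    SomeNonzero-insertAt : ∀ (pre : List X) cs s w ws → SomeNonzero cs (pre ++ ws) →
                           SomeNonzero (insertAt (length pre) cs s) (pre ++ w ∷ ws)
    SomeNonzero-insertAt []        cs       s w ws nz          = inj₂ nz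
    SomeNonzero-insertAt (x ∷ pre) (c ∷ cs) s w ws (inj₁ c≢0) = inj₁ c≢0
    SomeNonzero-insertAt (x ∷ pre) (c ∷ cs) s w ws (inj₂ nz)  = inj₂ (SomeNonzero-insertAt pre cs s w ws nz)

    weightedSum : List Carrier → List Carrier → Carrier
    weightedSum []       _        = 0F
    weightedSum (_ ∷ _)  []       = 0F
    weightedSum (a ∷ as) (k ∷ ks) = (a *F k) +F weightedSum as ks

    -- Gaussian elimination of the g-coordinate with the pivot w = c·g ⊕ Σ cw·gs, c ≠ 0.
    module Elimination (g : X) (gs : List X) (w : X) (c c⁻¹ : Carrier) (cc⁻¹≡1 : c *F c⁻¹ ≡ 1F)
                       (cw : List Carrier) (w≡ : (c · g) ⊕ lincomb cw gs ≡ w) where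

      multiplier : ∀ {u} → Span (g ∷ gs) u → Carrier
      multiplier (cs , _) = lead cs *F c⁻¹

      eliminate : ∀ {u} → Span (g ∷ gs) u → X
      eliminate {u} p = u ⊕ ((-F multiplier p) · w)

      eliminate-Span : ∀ {u} (p : Span (g ∷ gs) u) → Span gs (eliminate p)
      eliminate-Span (cs , refl) = rest cs +ᶜ map ((-F k) *F_) cw , (begin
          lincomb (rest cs +ᶜ map ((-F k) *F_) cw) gs
            ≡⟨ trans (lincomb-+ᶜ (rest cs) _ gs) (cong (lincomb (rest cs) gs ⊕_) (lincomb-scale (-F k) cw gs)) ⟩
          L
            ≡⟨ sym (⊕-identityˡ L) ⟩
          𝟎 ⊕ L
            ≡⟨ cong (_⊕ L) (trans (sym (·-zeroˡ g)) (cong (_· g) (sym (x+-[x*y]*c≡0 (lead cs) c⁻¹ c cc⁻¹≡1)))) ⟩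
          ((lead cs +F ((-F k) *F c)) · g) ⊕ L
            ≡⟨ cong (_⊕ L) (trans (·-distribʳ _ _ g) (cong ((lead cs · g) ⊕_) (·-assoc _ _ g))) ⟩
          ((lead cs · g) ⊕ ((-F k) · (c · g))) ⊕ L
            ≡⟨ ⊕-interchange _ _ _ _ ⟩
          ((lead cs · g) ⊕ lincomb (rest cs) gs) ⊕ (((-F k) · (c · g)) ⊕ ((-F k) · lincomb cw gs))
            ≡⟨ cong₂ _⊕_ (sym (lincomb-∷ g gs cs)) (trans (sym (·-distribˡ _ _ _)) (cong ((-F k) ·_) w≡)) ⟩
          lincomb cs (g ∷ gs) ⊕ ((-F k) · w)
            ∎)
        where
        k = lead cs *F c⁻¹
        L = lincomb (rest cs) gs ⊕ ((-F k) · lincomb cw gs)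

      eliminateAll : ∀ {us} → All (Span (g ∷ gs)) us → List X
      eliminateAll = All.reduce eliminate

      eliminateAll-Span : ∀ {us} (ps : All (Span (g ∷ gs)) us) → All (Span gs) (eliminateAll ps)
      eliminateAll-Span []       = []
      eliminateAll-Span (p ∷ ps) = eliminate-Span p ∷ eliminateAll-Span ps

      𝟎≡𝟎⊕-0·w : 𝟎 ≡ 𝟎 ⊕ ((-F 0F) · w)
      𝟎≡𝟎⊕-0·w = sym (trans (cong (λ t → 𝟎 ⊕ (t · w)) -0#≈0#)
                         (trans (cong (𝟎 ⊕_) (·-zeroˡ w)) (⊕-identityˡ 𝟎)))

      lincomb-eliminateAll : ∀ as {us} (ps : All (Span (g ∷ gs)) us) →
        lincomb as (eliminateAll ps) ≡ lincomb as us ⊕ ((-F weightedSum as (All.reduce multiplier ps)) · w)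
      lincomb-eliminateAll []       ps       = 𝟎≡𝟎⊕-0·w
      lincomb-eliminateAll (a ∷ as) []       = 𝟎≡𝟎⊕-0·w
      lincomb-eliminateAll (a ∷ as) {u ∷ us} (p ∷ ps) = begin
          (a · (u ⊕ ((-F k) · w))) ⊕ lincomb as (eliminateAll ps)
            ≡⟨ cong₂ _⊕_ (·-distribˡ a u _) (lincomb-eliminateAll as ps) ⟩
          ((a · u) ⊕ (a · ((-F k) · w))) ⊕ (lincomb as us ⊕ ((-F S) · w))
            ≡⟨ ⊕-interchange _ _ _ _ ⟩
          ((a · u) ⊕ lincomb as us) ⊕ ((a · ((-F k) · w)) ⊕ ((-F S) · w))
            ≡⟨ cong (((a · u) ⊕ lincomb as us) ⊕_)
                 (trans (cong (_⊕ ((-F S) · w)) (sym (·-assoc a (-F k) w))) (sym (·-distribʳ _ _ w))) ⟩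
          ((a · u) ⊕ lincomb as us) ⊕ (((a *F (-F k)) +F (-F S)) · w)
            ≡⟨ cong (λ t → ((a · u) ⊕ lincomb as us) ⊕ (t · w)) (sym (-[x*y+z]≡x*-y+-z a k S)) ⟩
          ((a · u) ⊕ lincomb as us) ⊕ ((-F ((a *F k) +F S)) · w)
            ∎
        where
        k = multiplier p
        S = weightedSum as (All.reduce multiplier ps)

    steinitz : ∀ gs ws → All (Span gs) ws → length gs < length ws → LinDependent ws

    -- ws is scanned for a pivot; vectors without g-coordinate are moved to pre
    steinitz-∷ : ∀ g gs pre ws → All (Span gs) pre → All (Span (g ∷ gs)) ws →
                 suc (length gs) < length pre + length ws → LinDependent (pre ++ ws)

    steinitz [] (w ∷ ws) ((cs , w≡) ∷ _) _ =
      1F ∷ [] , trans (cong (_⊕ 𝟎) (·-identity w)) (trans (⊕-identityʳ w) (trans (sym w≡) (lincomb-[]ʳ cs))) ,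
      inj₁ (0≢1 ∘ sym)
    steinitz (g ∷ gs) ws ws⊆ lt = steinitz-∷ g gs [] ws [] ws⊆ lt

    steinitz-∷ g gs pre [] pre⊆ [] lt =
      subst LinDependent (sym (List.++-identityʳ pre))
        (steinitz gs pre pre⊆ (<-trans (n<1+n _) (subst (suc (length gs) <_) (+-identityʳ _) lt)))
    steinitz-∷ g gs pre (w ∷ ws) pre⊆ ((cw , w≡) ∷ ws⊆) lt with lead cw ≟F 0F
    ... | yes c≡0 =
      subst LinDependent (List.++-assoc pre (w ∷ []) ws)
        (steinitz-∷ g gs (pre ++ w ∷ []) ws (++⁺ pre⊆ ((rest cw , w∈) ∷ [])) ws⊆ lt′)
      where
      𝟎≡lead·g : 𝟎 ≡ lead cw · g
      𝟎≡lead·g = trans (sym (·-zeroˡ g)) (cong (_· g) (sym c≡0))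
      w∈ : lincomb (rest cw) gs ≡ w
      w∈ = begin
        lincomb (rest cw) gs                     ≡⟨ sym (⊕-identityˡ _) ⟩
        𝟎 ⊕ lincomb (rest cw) gs                 ≡⟨ cong (_⊕ lincomb (rest cw) gs) 𝟎≡lead·g ⟩
        (lead cw · g) ⊕ lincomb (rest cw) gs     ≡⟨ sym (lincomb-∷ g gs cw) ⟩
        lincomb cw (g ∷ gs)                      ≡⟨ w≡ ⟩
        w                                        ∎
      lt′ : suc (length gs) < length (pre ++ w ∷ []) + length ws
      lt′ = subst (suc (length gs) <_)
              (trans (+-suc (length pre) (length ws))
                (cong (_+ length ws) (trans (+-comm 1 (length pre)) (sym (List.length-++ pre))))) lt
    -- Clearing the g-coordinate of the others with the pivot w leaves more vectors than gs in span gs;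
    -- a dependence a among them lifts to pre ++ w ∷ ws with coefficient −Σ aᵢkᵢ on w.
    ... | no c≢0 =
      insertAt (length pre) a (-F S) ,
      trans (lincomb-insertAt pre a (-F S) w ws) (trans (sym (lincomb-eliminateAll a ps)) (proj₁ (proj₂ dep))) ,
      SomeNonzero-insertAt pre a (-F S) w ws
        (SomeNonzero-length a (length-reduce eliminate ps) (proj₂ (proj₂ dep)))
      where
      c   = lead cw
      c⁻¹ = proj₁ (inverse c c≢0)
      open Elimination g gs w c c⁻¹ (proj₂ (inverse c c≢0)) (rest cw) (trans (sym (lincomb-∷ g gs cw)) w≡)
      ps  = ++⁺ (All.map (Span-weaken g gs) pre⊆) ws⊆
      lt′ : length gs < length (eliminateAll ps)
      lt′ = subst (length gs <_) (sym (trans (length-reduce eliminate ps) (List.length-++ pre)))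
              (s<s⁻¹ (subst (suc (length gs) <_) (+-suc (length pre) (length ws)) lt))
      dep = steinitz gs (eliminateAll ps) (eliminateAll-Span ps) lt′
      a   = proj₁ dep
      S   = weightedSum a (All.reduce multiplier ps)

    LinIndependent-[] : LinIndependent []
    LinIndependent-[] ([]    , _ , ())
    LinIndependent-[] (_ ∷ _ , _ , ())

    LinIndependent-tail : ∀ x ws → LinIndependent (x ∷ ws) → LinIndependent ws
    LinIndependent-tail x ws ind (cs , lc≡𝟎 , nz) =
      ind (0F ∷ cs , trans (cong (_⊕ lincomb cs ws) (·-zeroˡ x)) (trans (⊕-identityˡ _) lc≡𝟎) , inj₂ nz)

    LinIndependent-drop : ∀ k ws → LinIndependent ws → LinIndependent (drop k ws)
    LinIndependent-drop zero    ws       ind = ind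
    LinIndependent-drop (suc k) []       ind = ind
    LinIndependent-drop (suc k) (x ∷ ws) ind = LinIndependent-drop k ws (LinIndependent-tail x ws ind)

    x⊕y≡𝟎⇒x≡-1·y : ∀ x y → x ⊕ y ≡ 𝟎 → x ≡ (-F 1F) · y
    x⊕y≡𝟎⇒x≡-1·y x y x⊕y≡𝟎 = begin
      x                               ≡⟨ sym (⊕-identityʳ x) ⟩
      x ⊕ 𝟎                           ≡⟨ cong (x ⊕_) (sym (trans (cong (_⊕ ((-F 1F) · y)) (sym (·-identity y))) (a·x⊕-a·x≡𝟎 1F y))) ⟩
      x ⊕ (y ⊕ ((-F 1F) · y))         ≡⟨ sym (⊕-assoc x y _) ⟩
      (x ⊕ y) ⊕ ((-F 1F) · y)         ≡⟨ cong (_⊕ ((-F 1F) · y)) x⊕y≡𝟎 ⟩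
      𝟎 ⊕ ((-F 1F) · y)               ≡⟨ ⊕-identityˡ _ ⟩
      (-F 1F) · y                     ∎

    LinIndependent-∷ : ∀ x ws → LinIndependent ws → ¬ Span ws x → LinIndependent (x ∷ ws)
    LinIndependent-∷ x ws ind x∉ ([] , _ , ())
    LinIndependent-∷ x ws ind x∉ (c ∷ cs , lc≡𝟎 , nz) with c ≟F 0F
    ... | yes c≡0 = ind (cs , lc′≡𝟎 , nz′ nz)
      where
      lc′≡𝟎 : lincomb cs ws ≡ 𝟎
      lc′≡𝟎 = trans (sym (⊕-identityˡ _))
                (trans (cong (_⊕ lincomb cs ws) (trans (sym (·-zeroˡ x)) (cong (_· x) (sym c≡0)))) lc≡𝟎)
      nz′ : c ≢ 0F ⊎ SomeNonzero cs ws → SomeNonzero cs ws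
      nz′ (inj₁ c≢0) = contradiction c≡0 c≢0
      nz′ (inj₂ nz)  = nz
    ... | no c≢0 = x∉ (map ((c⁻¹ *F (-F 1F)) *F_) cs , (begin
        lincomb (map ((c⁻¹ *F (-F 1F)) *F_) cs) ws  ≡⟨ lincomb-scale _ cs ws ⟩
        (c⁻¹ *F (-F 1F)) · lincomb cs ws            ≡⟨ ·-assoc c⁻¹ (-F 1F) _ ⟩
        c⁻¹ · ((-F 1F) · lincomb cs ws)             ≡⟨ cong (c⁻¹ ·_) (sym (x⊕y≡𝟎⇒x≡-1·y (c · x) _ lc≡𝟎)) ⟩
        c⁻¹ · (c · x)                               ≡⟨ sym (·-assoc c⁻¹ c x) ⟩
        (c⁻¹ *F c) · x                              ≡⟨ cong (_· x) (trans (R.*-comm c⁻¹ c) (proj₂ (inverse c c≢0))) ⟩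
        1F · x                                      ≡⟨ ·-identity x ⟩
        x                                           ∎))
      where c⁻¹ = proj₁ (inverse c c≢0)

    ⊆ᵇ⇒⊆ : ∀ p q → (p ⊆ᵇ q) ≡ true → p ⊆ q
    ⊆ᵇ⇒⊆ p q e v pv with all-true⁻ _ e v (∈-allX v)
    ... | ¬pv∨qv rewrite pv = ¬pv∨qv

    ⊆⇒⊆ᵇ : ∀ p q → p ⊆ q → (p ⊆ᵇ q) ≡ true
    ⊆⇒⊆ᵇ p q p⊆q = all-true⁺ _ allX (λ v _ → ¬pv∨qv v)
      where
      ¬pv∨qv : ∀ v → not (p v) ∨ q v ≡ true
      ¬pv∨qv v with p v in pv
      ... | true  = p⊆q v pv
      ... | false = refl

    Generates : Pred → List X → Set
    Generates p gs = AllIn p gs × (∀ v → p v ≡ true → Span gs v)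

    greedy : ∀ p (xs acc : List X) → LinIndependent acc → AllIn p acc →
             ∃ λ B → LinIndependent B × AllIn p B × (∀ x → x ∈ xs → p x ≡ true → Span B x)
                   × (∀ v → Span acc v → Span B v)
    greedy p []       acc ind acc⊆p = acc , ind , acc⊆p , (λ _ ()) , (λ _ s → s)
    greedy p (x ∷ xs) acc ind acc⊆p with p x in px | inSpan acc x in x∈?
    ... | false | _ =
      let B , indB , B⊆p , spanB , acc⊆B = greedy p xs acc ind acc⊆p
      in B , indB , B⊆p ,
         (λ { y (here refl) py → contradiction px (≡true⇒≢false py) ; y (there y∈) → spanB y y∈ }) , acc⊆B
    ... | true | true =
      let B , indB , B⊆p , spanB , acc⊆B = greedy p xs acc ind acc⊆p
      in B , indB , B⊆p ,
         (λ { y (here refl) _ → acc⊆B y (inSpan⇒Span acc y x∈?) ; y (there y∈) → spanB y y∈ }) , acc⊆B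
    ... | true | false =
      let B , indB , B⊆p , spanB , acc⊆B =
            greedy p xs (x ∷ acc) (LinIndependent-∷ x acc ind (λ s → ≡true⇒≢false (Span⇒inSpan acc x s) x∈?))
                   (λ { y (here refl) → px ; y (there y∈) → acc⊆p y y∈ })
      in B , indB , B⊆p ,
         (λ { y (here refl) _ → acc⊆B y (Span-∈ (x ∷ acc) (here refl)) ; y (there y∈) → spanB y y∈ }) ,
         (λ v s → acc⊆B v (Span-trans acc (x ∷ acc) (λ g g∈ → Span-∈ (x ∷ acc) (there g∈)) s))

    basis : ∀ p → ∃ λ B → LinIndependent B × Generates p B
    basis p = let B , indB , B⊆p , spanB , _ = greedy p allX [] LinIndependent-[] (λ _ ())
              in B , indB , B⊆p , (λ v pv → spanB v (∈-allX v) pv)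

    hasSpanningOfSize-complete : ∀ p gs → Generates p gs → hasSpanningOfSize p (length gs) ≡ true
    hasSpanningOfSize-complete p gs (gs⊆p , span-p) =
      any-true⁺ (λ v → spans p (toList v))
        (∈-vecsOf (fromList⁺ (All.tabulate λ {x} x∈ → ∈-filterᵇ⁺ p (∈-allX x) (gs⊆p x x∈))))
        (subst (λ l → spans p l ≡ true) (sym (Vec.toList∘fromList gs))
          (∧-true (all-true⁺ p gs gs⊆p) (⊆⇒⊆ᵇ p (inSpan gs) (λ v pv → Span⇒inSpan gs v (span-p v pv)))))

    hasSpanningOfSize-sound : ∀ p d → hasSpanningOfSize p d ≡ true → ∃ λ gs → length gs ≡ d × Generates p gs
    hasSpanningOfSize-sound p d e =
      let v , _ , spans-v = any-true⁻ _ (vecsOf (filterᵇ p allX) d) e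
      in toList v , Vec.length-toList v , all-true⁻ p (∧-conicalˡ _ _ spans-v) ,
         (λ u pu → inSpan⇒Span (toList v) u (⊆ᵇ⇒⊆ p _ (∧-conicalʳ _ _ spans-v) u pu))

    private
      fuel : ℕ
      fuel = suc (length allX)

      dim<fuel : ∀ p → dim p < fuel
      dim<fuel p = ≤-<-trans (search-minimal _ fuel 0 _ z≤n (s≤s filter≤) (hasSpanningOfSize-complete p _ filter-generates))
                             (s≤s filter≤)
        where
        filter≤ = List.length-filter (T? ∘ p) allX
        filter-generates : Generates p (filterᵇ p allX)
        filter-generates = (λ x → ∈-filterᵇ⁻ p allX) , (λ v pv → Span-∈ _ (∈-filterᵇ⁺ p (∈-allX v) pv))

    dim≤length : ∀ p gs → Generates p gs → dim p ≤ length gs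
    dim≤length p gs gen with length gs <? fuel
    ... | yes lt  = search-minimal _ fuel 0 (length gs) z≤n lt (hasSpanningOfSize-complete p gs gen)
    ... | no  ≮fuel = <⇒≤ (<-≤-trans (dim<fuel p) (≮⇒≥ ≮fuel))

    dim-generating : ∀ p → ∃ λ gs → length gs ≡ dim p × Generates p gs
    dim-generating p with search-hit (hasSpanningOfSize p) fuel 0
    ... | inj₁ dim≡fuel = contradiction dim≡fuel (<⇒≢ (dim<fuel p))
    ... | inj₂ hit      = hasSpanningOfSize-sound p (dim p) hit

    length≤dim : ∀ p ws → LinIndependent ws → AllIn p ws → length ws ≤ dim p
    length≤dim p ws ind ws⊆p with dim-generating p | length ws ≤? dim p
    ... | _            | yes ≤dim = ≤dim
    ... | gs , len≡ , _ , span-p | no ≰dim =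
      contradiction (steinitz gs ws (All.tabulate λ {x} x∈ → span-p x (ws⊆p x x∈))
                                   (subst (_< length ws) (sym len≡) (≰⇒> ≰dim))) ind

    dim≡length-basis : ∀ p B → LinIndependent B → Generates p B → dim p ≡ length B
    dim≡length-basis p B ind gen = ≤-antisym (dim≤length p B gen) (length≤dim p B ind (proj₁ gen))

    dim-mono : ∀ p q → p ⊆ q → dim p ≤ dim q
    dim-mono p q p⊆q = let B , indB , genB = basis p in
      subst (_≤ dim q) (sym (dim≡length-basis p B indB genB)) (length≤dim q B indB (λ x x∈ → p⊆q x (proj₁ genB x x∈)))

    dim-cong : ∀ p q → p ≗ q → dim p ≡ dim q
    dim-cong p q p≗q = ≤-antisym (dim-mono p q (λ v pv → trans (sym (p≗q v)) pv)) (dim-mono q p (λ v qv → trans (p≗q v) qv))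

    dim-mono-< : ∀ p q → IsSubspace p → p ⊆ q → ∀ v → q v ≡ true → p v ≡ false → dim p < dim q
    dim-mono-< p q p-sub p⊆q v qv pv = let B , indB , B⊆p , span-p = basis p in
      subst (_< dim q) (sym (dim≡length-basis p B indB (B⊆p , span-p)))
        (length≤dim q (v ∷ B) (LinIndependent-∷ v B indB (λ s → ≡true⇒≢false (Span⊆subspace p p-sub B B⊆p s) pv))
                    (λ { x (here refl) → qv ; x (there x∈) → p⊆q x (B⊆p x x∈) }))

    ⊆∧dim≥⇒⊇ : ∀ p q → IsSubspace p → p ⊆ q → dim q ≤ dim p → q ⊆ p
    ⊆∧dim≥⇒⊇ p q p-sub p⊆q dimq≤dimp v qv with p v in pv
    ... | true  = refl
    ... | false = contradiction dimq≤dimp (<⇒≱ (dim-mono-< p q p-sub p⊆q v qv pv))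

    dim≡0⇒⊆𝟎 : ∀ p → dim p ≡ 0 → ∀ v → p v ≡ true → v ≡ 𝟎
    dim≡0⇒⊆𝟎 p dim≡0 v pv with dim-generating p
    ... | []    , _    , _ , span-p = let cs , e = span-p v pv in trans (sym e) (lincomb-[]ʳ cs)
    ... | _ ∷ _ , len≡ , _          = contradiction (trans (sym dim≡0) (sym len≡)) 0≢1+n

    ⊆𝟎⇒dim≡0 : ∀ p → (∀ v → p v ≡ true → v ≡ 𝟎) → dim p ≡ 0
    ⊆𝟎⇒dim≡0 p p⊆𝟎 = n≤0⇒n≡0 (dim≤length p [] ((λ _ ()) , λ v pv → [] , sym (p⊆𝟎 v pv)))

    inSpan-basis : ∀ p → IsSubspace p → ∀ B → Generates p B → inSpan B ≗ p
    inSpan-basis p p-sub B (B⊆p , span-p) v =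
      ⇔true⇒≡ (Span⊆subspace p p-sub B B⊆p ∘ inSpan⇒Span B v) (Span⇒inSpan B v ∘ span-p v)

    subspace-of-dim : ∀ p → IsSubspace p → ∀ r → r ≤ dim p → ∃ λ D → IsSubspace D × D ⊆ p × dim D ≡ r
    subspace-of-dim p p-sub r r≤dim = let B , indB , B⊆p , span-p = basis p
                                          k  = dim p ∸ r
                                          B′ = drop k B
      in inSpan B′ , inSpan-isSubspace B′ ,
         (λ v v∈ → Span⊆subspace p p-sub B′ (λ x → All.lookup (drop⁺ k (All.tabulate (B⊆p _))))
                                 (inSpan⇒Span B′ v v∈)) ,
         (begin
           dim (inSpan B′)  ≡⟨ dim≡length-basis (inSpan B′) B′ (LinIndependent-drop k B indB)
                                 ((λ x x∈ → Span⇒inSpan B′ x (Span-∈ B′ x∈)) , inSpan⇒Span B′) ⟩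
           length B′        ≡⟨ List.length-drop k B ⟩
           length B ∸ k     ≡⟨ cong (_∸ k) (sym (dim≡length-basis p B indB (B⊆p , span-p))) ⟩
           dim p ∸ k        ≡⟨ m∸[m∸n]≡n r≤dim ⟩
           r                ∎)

    IsLinearForm : (X → Carrier) → Set
    IsLinearForm f = (∀ x y → f (x ⊕ y) ≡ f x +F f y) × (∀ a x → f (a · x) ≡ a *F f x)

    kernelIn : (X → Carrier) → Pred → Pred
    kernelIn f U v = ⌊ f v ≟F 0F ⌋ ∧ U v

    module _ {f : X → Carrier} (f-linear : IsLinearForm f) {U : Pred} (U-sub : IsSubspace U) where
      private
        f-⊕ = proj₁ f-linear
        f-· = proj₂ f-linear
        U-𝟎 = proj₁ U-sub
        U-⊕ = proj₁ (proj₂ U-sub)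
        U-· = proj₂ (proj₂ U-sub)

        ∈kernel⇒f≡0 : ∀ {x} → kernelIn f U x ≡ true → f x ≡ 0F
        ∈kernel⇒f≡0 kx = ⌊⌋-true⁻ (f _ ≟F 0F) (∧-conicalˡ _ _ kx)

        ∈kernel⇒∈U : ∀ {x} → kernelIn f U x ≡ true → U x ≡ true
        ∈kernel⇒∈U = ∧-conicalʳ _ _

      kernelIn-isSubspace : IsSubspace (kernelIn f U)
      kernelIn-isSubspace =
          ∧-true (⌊⌋-true⁺ (f 𝟎 ≟F 0F) (trans (cong f (sym (·-zeroˡ 𝟎))) (trans (f-· 0F 𝟎) (R.zeroˡ _)))) U-𝟎
        , (λ x y kx ky → ∧-true
             (⌊⌋-true⁺ (f _ ≟F 0F) (trans (f-⊕ x y)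
               (trans (cong₂ _+F_ (∈kernel⇒f≡0 kx) (∈kernel⇒f≡0 ky)) (R.+-identityʳ 0F))))
             (U-⊕ x y (∈kernel⇒∈U kx) (∈kernel⇒∈U ky)))
        , (λ a x kx → ∧-true
             (⌊⌋-true⁺ (f _ ≟F 0F) (trans (f-· a x) (trans (cong (a *F_) (∈kernel⇒f≡0 kx)) (R.zeroʳ a))))
             (U-· a x (∈kernel⇒∈U kx)))

      Generates-∷-kernelIn : ∀ u → U u ≡ true → f u ≢ 0F → ∀ BK → Generates (kernelIn f U) BK → Generates U (u ∷ BK)
      Generates-∷-kernelIn u Uu fu≢0 BK (BK⊆K , span-K) = u∷BK⊆U , (λ v Uv → lift v (span-K _ (residual∈K v Uv)))
        where
        fu⁻¹ = proj₁ (inverse (f u) fu≢0)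

        k : X → Carrier
        k v = f v *F fu⁻¹

        u∷BK⊆U : AllIn U (u ∷ BK)
        u∷BK⊆U _ (here refl) = Uu
        u∷BK⊆U x (there x∈) = ∈kernel⇒∈U (BK⊆K x x∈)

        residual∈K : ∀ v → U v ≡ true → kernelIn f U (v ⊕ ((-F k v) · u)) ≡ true
        residual∈K v Uv = ∧-true
          (⌊⌋-true⁺ (f _ ≟F 0F) (trans (f-⊕ v _)
            (trans (cong (f v +F_) (f-· (-F k v) u)) (x+-[x*y]*c≡0 (f v) fu⁻¹ (f u) (proj₂ (inverse (f u) fu≢0))))))
          (U-⊕ v _ Uv (U-· (-F k v) u Uu))

        lift : ∀ v → Span BK (v ⊕ ((-F k v) · u)) → Span (u ∷ BK) v
        lift v (cs , e) = k v ∷ cs , (begin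
          (k v · u) ⊕ lincomb cs BK                ≡⟨ cong ((k v · u) ⊕_) (trans e (⊕-comm v _)) ⟩
          (k v · u) ⊕ (((-F k v) · u) ⊕ v)         ≡⟨ sym (⊕-assoc _ _ v) ⟩
          ((k v · u) ⊕ ((-F k v) · u)) ⊕ v         ≡⟨ cong (_⊕ v) (a·x⊕-a·x≡𝟎 (k v) u) ⟩
          𝟎 ⊕ v                                    ≡⟨ ⊕-identityˡ v ⟩
          v                                        ∎)

      dim≤suc-dim-kernelIn : dim U ≤ suc (dim (kernelIn f U))
      dim≤suc-dim-kernelIn with any (λ u → U u ∧ not ⌊ f u ≟F 0F ⌋) allX in outside
      ... | false = ≤-trans (dim-mono U (kernelIn f U) U⊆K) (n≤1+n _)
        where
        U⊆K : U ⊆ kernelIn f U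
        U⊆K v Uv with f v ≟F 0F in fv≟0
        ... | yes _    = Uv
        ... | no _     = ⊥-elim (≡true⇒≢false (any-true⁺ _ (∈-allX v) (∧-true Uv (cong (not ∘ ⌊_⌋) fv≟0))) outside)
      ... | true =
        let u , _ , Uu∧fu≢0 = any-true⁻ _ allX outside
            BK , indBK , genBK = basis (kernelIn f U)
        in subst (λ d → dim U ≤ suc d) (sym (dim≡length-basis _ BK indBK genBK))
             (dim≤length U (u ∷ BK)
               (Generates-∷-kernelIn u (∧-conicalˡ _ _ Uu∧fu≢0)
                  (λ fu≡0 → ≡true⇒≢false (∧-conicalʳ _ _ Uu∧fu≢0) (cong not (⌊⌋-true⁺ (f u ≟F 0F) fu≡0)))
                  BK genBK))

    minimal-subspace : (Q : Pred → Set) → (∀ p → Dec (Q p)) → (∀ {p q} → p ≗ q → Q p → Q q) →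
                       ∀ Z₀ → IsSubspace Z₀ → Q Z₀ →
                       ∃ λ Z → IsSubspace Z × Q Z × (∀ Z′ → IsSubspace Z′ → Q Z′ → dim Z ≤ dim Z′)
    minimal-subspace Q Q? Q-resp Z₀ Z₀-sub QZ₀ = inSpan L , inSpan-isSubspace L , QL , L-minimal
      where
      admissible : List X → Bool
      admissible B = ⌊ Q? (inSpan B) ⌋

      -- a basis of every subspace occurs among the candidates
      short : List (List X)
      short = listsOf allX (dim (λ _ → true))

      candidates : List (List X)
      candidates = filterᵇ admissible short

      Q-basis : ∀ Z → IsSubspace Z → Q Z → Q (inSpan (proj₁ (basis Z)))
      Q-basis Z Z-sub QZ = let B , _ , genB = basis Z in Q-resp (λ v → sym (inSpan-basis Z Z-sub B genB v)) QZ

      B₀ : List X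
      B₀ = proj₁ (basis Z₀)

      L : List X
      L = argmin (dim ∘ inSpan) B₀ candidates

      QL : Q (inSpan L)
      QL = argmin-all (dim ∘ inSpan) {B₀} {candidates} {P = Q ∘ inSpan} (Q-basis Z₀ Z₀-sub QZ₀)
             (All.tabulate (λ B∈ → ⌊⌋-true⁻ (Q? _) (∈-filterᵇ⁻ admissible short B∈)))

      L-minimal : ∀ Z′ → IsSubspace Z′ → Q Z′ → dim (inSpan L) ≤ dim Z′
      L-minimal Z′ Z′-sub QZ′ =
        let B′ , indB′ , genB′ = basis Z′
            B′∈ = ∈-filterᵇ⁺ admissible (∈-listsOf ∈-allX _ B′ (length≤dim _ B′ indB′ (λ _ _ → refl)))
                                         (⌊⌋-true⁺ (Q? _) (Q-basis Z′ Z′-sub QZ′))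
        in subst (dim (inSpan L) ≤_) (dim-cong _ _ (inSpan-basis Z′ Z′-sub B′ genB′))
             (All.lookup (f[argmin]≤f[xs] {f = dim ∘ inSpan} B₀ candidates) B′∈)

  field-laws : VectorSpaceLaws Carrier _+F_ _*F_ 0F
  field-laws = record
    { ⊕-assoc = R.+-assoc ; ⊕-comm = R.+-comm ; ⊕-identityˡ = R.+-identityˡ
    ; ·-distribˡ = R.distribˡ ; ·-distribʳ = λ a b x → R.distribʳ x a b
    ; ·-assoc = R.*-assoc ; ·-identity = R.*-identityˡ ; ·-zeroˡ = R.zeroˡ }

  Vec-laws : ∀ {X _⊕_ _·_ 𝟎} → VectorSpaceLaws X _⊕_ _·_ 𝟎 → ∀ k →
             VectorSpaceLaws (Vec X k) (Vec.zipWith _⊕_) (λ a → Vec.map (a ·_)) (replicate k 𝟎)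
  Vec-laws {X} {_⊕_} {_·_} {𝟎} L k = record
    { ⊕-assoc = assoc ; ⊕-comm = comm ; ⊕-identityˡ = identityˡ ; ·-distribˡ = distribˡ ; ·-distribʳ = distribʳ
    ; ·-assoc = ·assoc ; ·-identity = identity ; ·-zeroˡ = zeroˡ }
    where
    open VectorSpaceLaws L
    assoc : ∀ {k} (x y z : Vec X k) → Vec.zipWith _⊕_ (Vec.zipWith _⊕_ x y) z ≡ Vec.zipWith _⊕_ x (Vec.zipWith _⊕_ y z)
    assoc []      []      []      = refl
    assoc (a ∷ x) (b ∷ y) (c ∷ z) = cong₂ _∷_ (⊕-assoc a b c) (assoc x y z)
    comm : ∀ {k} (x y : Vec X k) → Vec.zipWith _⊕_ x y ≡ Vec.zipWith _⊕_ y x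
    comm []      []      = refl
    comm (a ∷ x) (b ∷ y) = cong₂ _∷_ (⊕-comm a b) (comm x y)
    identityˡ : ∀ {k} (x : Vec X k) → Vec.zipWith _⊕_ (replicate k 𝟎) x ≡ x
    identityˡ []      = refl
    identityˡ (a ∷ x) = cong₂ _∷_ (⊕-identityˡ a) (identityˡ x)
    distribˡ : ∀ {k} a (x y : Vec X k) →
               Vec.map (a ·_) (Vec.zipWith _⊕_ x y) ≡ Vec.zipWith _⊕_ (Vec.map (a ·_) x) (Vec.map (a ·_) y)
    distribˡ a []      []      = refl
    distribˡ a (b ∷ x) (c ∷ y) = cong₂ _∷_ (·-distribˡ a b c) (distribˡ a x y)
    distribʳ : ∀ {k} a b (x : Vec X k) → Vec.map ((a +F b) ·_) x ≡ Vec.zipWith _⊕_ (Vec.map (a ·_) x) (Vec.map (b ·_) x)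
    distribʳ a b []      = refl
    distribʳ a b (c ∷ x) = cong₂ _∷_ (·-distribʳ a b c) (distribʳ a b x)
    ·assoc : ∀ {k} a b (x : Vec X k) → Vec.map ((a *F b) ·_) x ≡ Vec.map (a ·_) (Vec.map (b ·_) x)
    ·assoc a b []      = refl
    ·assoc a b (c ∷ x) = cong₂ _∷_ (·-assoc a b c) (·assoc a b x)
    identity : ∀ {k} (x : Vec X k) → Vec.map (1F ·_) x ≡ x
    identity []      = refl
    identity (c ∷ x) = cong₂ _∷_ (·-identity c) (identity x)
    zeroˡ : ∀ {k} (x : Vec X k) → Vec.map (0F ·_) x ≡ replicate k 𝟎
    zeroˡ []      = refl
    zeroˡ (c ∷ x) = cong₂ _∷_ (·-zeroˡ c) (zeroˡ x)

  ∈-allVect : ∀ n (x : Vect n) → x ∈ vecsOf elems n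
  ∈-allVect n x = ∈-vecsOf (VecAll.universal complete x)

  ∈-allMat : ∀ n m (A : Mat n m) → A ∈ vecsOf (vecsOf elems m) n
  ∈-allMat n m A = ∈-vecsOf (VecAll.universal (∈-allVect m) A)

  infixl 6 _⊕ᵛ_ _⊕ᴹ_
  infixr 7 _·ᵛ_ _·ᴹ_

  _⊕ᵛ_ : ∀ {n} → Vect n → Vect n → Vect n
  _⊕ᵛ_ = Vec.zipWith _+F_

  _·ᵛ_ : ∀ {n} → Carrier → Vect n → Vect n
  a ·ᵛ v = Vec.map (a *F_) v

  𝟎ᵛ : ∀ {n} → Vect n
  𝟎ᵛ = replicate _ 0F

  _⊕ᴹ_ : ∀ {n m} → Mat n m → Mat n m → Mat n m
  _⊕ᴹ_ = Vec.zipWith _⊕ᵛ_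

  _·ᴹ_ : ∀ {n m} → Carrier → Mat n m → Mat n m
  a ·ᴹ A = Vec.map (a ·ᵛ_) A

  𝟎ᴹ : ∀ {n m} → Mat n m
  𝟎ᴹ = replicate _ 𝟎ᵛ

  module Vectors (n : ℕ) = VectorSpace (Vect n) _⊕ᵛ_ _·ᵛ_ 𝟎ᵛ (Vec.≡-dec _≟F_) (vecsOf elems n)
                                       (Vec-laws field-laws n) (∈-allVect n)

  module Matrices (n m : ℕ) = VectorSpace (Mat n m) _⊕ᴹ_ _·ᴹ_ 𝟎ᴹ (Vec.≡-dec (Vec.≡-dec _≟F_))
                                          (vecsOf (vecsOf elems m) n) (Vec-laws (Vec-laws field-laws m) n)
                                          (∈-allMat n m)

  standardBasis : ∀ n → List (Vect n)
  standardBasis zero    = []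
  standardBasis (suc n) = (1F ∷ replicate n 0F) ∷ map (0F ∷_) (standardBasis n)

  length-standardBasis : ∀ n → length (standardBasis n) ≡ n
  length-standardBasis zero    = refl
  length-standardBasis (suc n) = cong suc (trans (List.length-map _ (standardBasis n)) (length-standardBasis n))

  coords : List Carrier → ∀ n → Vect n
  coords _        zero    = []
  coords []       (suc n) = 0F ∷ coords [] n
  coords (c ∷ cs) (suc n) = c ∷ coords cs n

  coords-[] : ∀ n → coords [] n ≡ replicate n 0F
  coords-[] zero    = refl
  coords-[] (suc n) = cong (0F ∷_) (coords-[] n)

  coords-toList : ∀ {n} (v : Vect n) → coords (toList v) n ≡ v
  coords-toList []      = refl
  coords-toList (c ∷ v) = cong (c ∷_) (coords-toList v)

  lincomb-map-0∷ : ∀ n cs gs → Vectors.lincomb (suc n) cs (map (0F ∷_) gs) ≡ 0F ∷ Vectors.lincomb n cs gs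
  lincomb-map-0∷ n []       gs       = refl
  lincomb-map-0∷ n (c ∷ cs) []       = refl
  lincomb-map-0∷ n (c ∷ cs) (g ∷ gs) rewrite lincomb-map-0∷ n cs gs =
    cong (_∷ (c ·ᵛ g ⊕ᵛ Vectors.lincomb n cs gs)) (trans (R.+-identityʳ _) (R.zeroʳ c))

  lincomb-standardBasis : ∀ n cs → Vectors.lincomb n cs (standardBasis n) ≡ coords cs n
  lincomb-standardBasis zero    cs       = Vectors.lincomb-[]ʳ 0 cs
  lincomb-standardBasis (suc n) []       = sym (coords-[] (suc n))
  lincomb-standardBasis (suc n) (c ∷ cs) = begin
    c ·ᵛ e₀ ⊕ᵛ lincomb (suc n) cs (map (0F ∷_) (standardBasis n))
      ≡⟨ cong (c ·ᵛ e₀ ⊕ᵛ_) (lincomb-map-0∷ n cs (standardBasis n)) ⟩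
    ((c *F 1F) +F 0F) ∷ (c ·ᵛ 𝟎ᵛ ⊕ᵛ lincomb n cs (standardBasis n))
      ≡⟨ cong₂ _∷_ (trans (R.+-identityʳ _) (R.*-identityʳ c))
                   (trans (cong (_⊕ᵛ _) (·-zeroʳ n c)) (trans (⊕-identityˡ n _) (lincomb-standardBasis n cs))) ⟩
    c ∷ coords cs n                                                   ∎
    where
    open ≡-Reasoning
    open Vectors using (lincomb; ·-zeroʳ; ⊕-identityˡ)
    e₀ = 1F ∷ replicate n 0F

  SomeNonzero⇒coords≢𝟎 : ∀ n cs → SomeNonzero cs (standardBasis n) → coords cs n ≢ replicate n 0F
  SomeNonzero⇒coords≢𝟎 (suc n) (c ∷ cs) (inj₁ c≢0) e = c≢0 (Vec.∷-injectiveˡ e)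
  SomeNonzero⇒coords≢𝟎 (suc n) (c ∷ cs) (inj₂ nz)  e =
    SomeNonzero⇒coords≢𝟎 n cs (SomeNonzero-length cs (List.length-map _ (standardBasis n)) nz) (Vec.∷-injectiveʳ e)

  dim-full : ∀ n → Vectors.dim n full ≡ n
  dim-full n = trans (dim≡length-basis full (standardBasis n) independent generates) (length-standardBasis n)
    where
    open Vectors n
    independent : LinIndependent (standardBasis n)
    independent (cs , lc≡𝟎 , nz) = SomeNonzero⇒coords≢𝟎 n cs nz (trans (sym (lincomb-standardBasis n cs)) lc≡𝟎)
    generates : Generates full (standardBasis n)
    generates = (λ _ _ → refl) , (λ v _ → toList v , trans (lincomb-standardBasis n (toList v)) (coords-toList v))

  -- Orthogonal complements in F^n

  dot-comm : ∀ {n} (u v : Vect n) → dot u v ≡ dot v u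
  dot-comm []      []      = refl
  dot-comm (a ∷ u) (b ∷ v) = cong₂ _+F_ (R.*-comm a b) (dot-comm u v)

  dot-⊕ˡ : ∀ {n} (u v w : Vect n) → dot (u ⊕ᵛ v) w ≡ dot u w +F dot v w
  dot-⊕ˡ []      []      []      = sym (R.+-identityˡ 0F)
  dot-⊕ˡ (a ∷ u) (b ∷ v) (c ∷ w) = trans (cong₂ _+F_ (R.distribʳ c a b) (dot-⊕ˡ u v w)) (+F-interchange _ _ _ _)

  dot-·ˡ : ∀ {n} a (u w : Vect n) → dot (a ·ᵛ u) w ≡ a *F dot u w
  dot-·ˡ a []      []      = sym (R.zeroʳ a)
  dot-·ˡ a (b ∷ u) (c ∷ w) = trans (cong₂ _+F_ (R.*-assoc a b c) (dot-·ˡ a u w)) (sym (R.distribˡ a _ _))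

  dot-𝟎ˡ : ∀ {n} (w : Vect n) → dot 𝟎ᵛ w ≡ 0F
  dot-𝟎ˡ []      = refl
  dot-𝟎ˡ (c ∷ w) = trans (cong₂ _+F_ (R.zeroˡ c) (dot-𝟎ˡ w)) (R.+-identityʳ 0F)

  dot-𝟎ʳ : ∀ {n} (v : Vect n) → dot v 𝟎ᵛ ≡ 0F
  dot-𝟎ʳ v = trans (dot-comm v 𝟎ᵛ) (dot-𝟎ˡ v)

  dot-linearˡ : ∀ {n} (b : Vect n) → Vectors.IsLinearForm n (λ v → dot v b)
  dot-linearˡ b = (λ x y → dot-⊕ˡ x y b) , (λ a x → dot-·ˡ a x b)

  dot-nondegenerate : ∀ {n} (v : Vect n) → (∀ w → dot v w ≡ 0F) → v ≡ 𝟎ᵛ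
  dot-nondegenerate []      _    = refl
  dot-nondegenerate (a ∷ v) v⊥ = cong₂ _∷_ a≡0 (dot-nondegenerate v (λ w → begin
      dot v w                  ≡⟨ sym (R.+-identityˡ _) ⟩
      0F +F dot v w            ≡⟨ cong (_+F dot v w) (sym (R.zeroʳ a)) ⟩
      (a *F 0F) +F dot v w     ≡⟨ v⊥ (0F ∷ w) ⟩
      0F                       ∎))
    where
    open ≡-Reasoning
    a≡0 : a ≡ 0F
    a≡0 = begin
      a                        ≡⟨ sym (trans (R.+-identityʳ _) (R.*-identityʳ a)) ⟩
      (a *F 1F) +F 0F          ≡⟨ cong ((a *F 1F) +F_) (sym (dot-𝟎ʳ v)) ⟩
      (a *F 1F) +F dot v 𝟎ᵛ    ≡⟨ v⊥ (1F ∷ 𝟎ᵛ) ⟩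
      0F                       ∎

  module Orthogonality (n : ℕ) where
    open Vectors n

    perp⇒⊥ : ∀ J v → perp J v ≡ true → ∀ w → J w ≡ true → dot v w ≡ 0F
    perp⇒⊥ J v v∈ w Jw = ⌊⌋-true⁻ (dot v w ≟F 0F) (⊆ᵇ⇒⊆ J (λ w → ⌊ dot v w ≟F 0F ⌋) v∈ w Jw)

    ⊥⇒perp : ∀ J v → (∀ w → J w ≡ true → dot v w ≡ 0F) → perp J v ≡ true
    ⊥⇒perp J v v⊥ = ⊆⇒⊆ᵇ J (λ w → ⌊ dot v w ≟F 0F ⌋) (λ w Jw → ⌊⌋-true⁺ (dot v w ≟F 0F) (v⊥ w Jw))

    perp-full⊆𝟎 : ∀ v → perp full v ≡ true → v ≡ 𝟎ᵛ
    perp-full⊆𝟎 v v∈ = dot-nondegenerate v (λ w → perp⇒⊥ full v v∈ w refl)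

    ⊆perp-perp : ∀ J → J ⊆ perp (perp J)
    ⊆perp-perp J v Jv = ⊥⇒perp (perp J) v (λ w w∈ → trans (dot-comm v w) (perp⇒⊥ J w w∈ v Jv))

    annihilator : List (Vect n) → Pred
    annihilator []       _ = true
    annihilator (b ∷ bs)   = kernelIn (λ v → dot v b) (annihilator bs)

    annihilator-isSubspace : ∀ bs → IsSubspace (annihilator bs)
    annihilator-isSubspace []       = refl , (λ _ _ _ _ → refl) , (λ _ _ _ → refl)
    annihilator-isSubspace (b ∷ bs) = kernelIn-isSubspace (dot-linearˡ b) (annihilator-isSubspace bs)

    ⊥⇒annihilator : ∀ v bs → (∀ b → b ∈ bs → dot v b ≡ 0F) → annihilator bs v ≡ true
    ⊥⇒annihilator v []       _   = refl
    ⊥⇒annihilator v (b ∷ bs) v⊥ =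
      ∧-true (⌊⌋-true⁺ (dot v b ≟F 0F) (v⊥ b (here refl))) (⊥⇒annihilator v bs (λ x → v⊥ x ∘ there))

    annihilator⇒⊥ : ∀ v bs → annihilator bs v ≡ true → ∀ b → b ∈ bs → dot v b ≡ 0F
    annihilator⇒⊥ v (b ∷ bs) v∈ _ (here refl) = ⌊⌋-true⁻ (dot v b ≟F 0F) (∧-conicalˡ _ _ v∈)
    annihilator⇒⊥ v (b ∷ bs) v∈ x (there x∈)  = annihilator⇒⊥ v bs (∧-conicalʳ _ _ v∈) x x∈

    perp≗annihilator : ∀ J B → Generates J B → perp J ≗ annihilator B
    perp≗annihilator J B (B⊆J , span-J) v = ⇔true⇒≡
      (λ v⊥J → ⊥⇒annihilator v B (λ b b∈ → perp⇒⊥ J v v⊥J b (B⊆J b b∈)))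
      (λ v⊥B → ⊥⇒perp J v (λ w Jw → ⊥Span (span-J w Jw) (annihilator⇒⊥ v B v⊥B)))
      where
      ⊥Span : ∀ {w} → Span B w → (∀ b → b ∈ B → dot v b ≡ 0F) → dot v w ≡ 0F
      ⊥Span (cs , refl) v⊥B = lincomb-closed (λ x → dot v x ≡ 0F) (dot-𝟎ʳ v)
        (λ {x} {y} x⊥ y⊥ → trans (dot-comm v (x ⊕ᵛ y))
          (trans (dot-⊕ˡ x y v) (trans (cong₂ _+F_ (trans (dot-comm x v) x⊥) (trans (dot-comm y v) y⊥)) (R.+-identityʳ 0F))))
        (λ a {x} x⊥ → trans (dot-comm v (a ·ᵛ x))
          (trans (dot-·ˡ a x v) (trans (cong (a *F_) (trans (dot-comm x v) x⊥)) (R.zeroʳ a))))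
        B v⊥B cs

    n≤dim-annihilator+length : ∀ bs → n ≤ dim (annihilator bs) + length bs
    n≤dim-annihilator+length []       = ≤-reflexive (sym (trans (+-identityʳ _) (dim-full n)))
    n≤dim-annihilator+length (b ∷ bs) = ≤-trans (n≤dim-annihilator+length bs)
      (subst (dim (annihilator bs) + length bs ≤_) (sym (+-suc _ (length bs)))
        (+-monoˡ-≤ (length bs) (dim≤suc-dim-kernelIn (dot-linearˡ b) (annihilator-isSubspace bs))))

    n≤dim-perp+dim : ∀ J → n ≤ dim (perp J) + dim J
    n≤dim-perp+dim J = let B , indB , genB = basis J in
      subst (n ≤_) (cong₂ _+_ (sym (dim-cong _ _ (perp≗annihilator J B genB))) (sym (dim≡length-basis J B indB genB)))
        (n≤dim-annihilator+length B)

  dotsWith : ∀ {n} (L : List (Vect n)) → Vect n → Vect (length L)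
  dotsWith []      v = []
  dotsWith (x ∷ L) v = dot v x ∷ dotsWith L v

  dotsWith-⊕ : ∀ {n} (L : List (Vect n)) u v → dotsWith L (u ⊕ᵛ v) ≡ dotsWith L u ⊕ᵛ dotsWith L v
  dotsWith-⊕ []      u v = refl
  dotsWith-⊕ (x ∷ L) u v = cong₂ _∷_ (dot-⊕ˡ u v x) (dotsWith-⊕ L u v)

  dotsWith-· : ∀ {n} (L : List (Vect n)) a v → dotsWith L (a ·ᵛ v) ≡ a ·ᵛ dotsWith L v
  dotsWith-· []      a v = refl
  dotsWith-· (x ∷ L) a v = cong₂ _∷_ (dot-·ˡ a v x) (dotsWith-· L a v)

  dotsWith-𝟎 : ∀ {n} (L : List (Vect n)) → dotsWith L 𝟎ᵛ ≡ 𝟎ᵛ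
  dotsWith-𝟎 []      = refl
  dotsWith-𝟎 (x ∷ L) = cong₂ _∷_ (dot-𝟎ˡ x) (dotsWith-𝟎 L)

  dot-dotsWith : ∀ {n} (L : List (Vect n)) (w : Vect (length L)) v → dot w (dotsWith L v) ≡ dot v (Vectors.lincomb n (toList w) L)
  dot-dotsWith []      []      v = sym (dot-𝟎ʳ v)
  dot-dotsWith (x ∷ L) (c ∷ w) v = begin
    (c *F dot v x) +F dot w (dotsWith L v)                   ≡⟨ cong₂ _+F_ (cong (c *F_) (dot-comm v x)) (dot-dotsWith L w v) ⟩
    (c *F dot x v) +F dot v (lincomb (toList w) L)           ≡⟨ cong₂ _+F_ (sym (dot-·ˡ c x v)) (dot-comm v _) ⟩
    dot (c ·ᵛ x) v +F dot (lincomb (toList w) L) v           ≡⟨ sym (dot-⊕ˡ (c ·ᵛ x) _ v) ⟩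
    dot (c ·ᵛ x ⊕ᵛ lincomb (toList w) L) v                   ≡⟨ dot-comm _ v ⟩
    dot v (lincomb (toList (c ∷ w)) (x ∷ L))                 ∎
    where
    open ≡-Reasoning
    open Vectors _ using (lincomb)

  dotsWith≡𝟎⇒⊥ : ∀ {n} (bs : List (Vect n)) v → dotsWith bs v ≡ 𝟎ᵛ → ∀ x → x ∈ bs → dot v x ≡ 0F
  dotsWith≡𝟎⇒⊥ (b ∷ bs) v e _ (here refl) = Vec.∷-injectiveˡ e
  dotsWith≡𝟎⇒⊥ (b ∷ bs) v e x (there x∈)  = dotsWith≡𝟎⇒⊥ bs v (Vec.∷-injectiveʳ e) x x∈

  zero⊎SomeNonzero : ∀ {A : Set} (L : List A) (w : Vect (length L)) → w ≡ 𝟎ᵛ ⊎ SomeNonzero (toList w) L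
  zero⊎SomeNonzero []      []      = inj₁ refl
  zero⊎SomeNonzero (x ∷ L) (c ∷ w) with c ≟F 0F | zero⊎SomeNonzero L w
  ... | no c≢0  | _         = inj₂ (inj₁ c≢0)
  ... | yes c≡0 | inj₁ w≡𝟎 = inj₁ (cong₂ _∷_ c≡0 w≡𝟎)
  ... | yes c≡0 | inj₂ nz  = inj₂ (inj₂ nz)

  module DotsWithImage {n} (L : List (Vect n)) where
    private
      d = length L
    open Vectors d

    image : Pred
    image w = any (λ v → ⌊ Vec.≡-dec _≟F_ (dotsWith L v) w ⌋) (vecsOf elems n)

    ∈image⁺ : ∀ v → image (dotsWith L v) ≡ true
    ∈image⁺ v = any-true⁺ (λ u → ⌊ Vec.≡-dec _≟F_ (dotsWith L u) (dotsWith L v) ⌋) (∈-allVect n v)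
                          (⌊⌋-true⁺ (Vec.≡-dec _≟F_ _ _) refl)

    ∈image⁻ : ∀ w → image w ≡ true → ∃ λ v → dotsWith L v ≡ w
    ∈image⁻ w e = let v , _ , v↦w = any-true⁻ _ (vecsOf elems n) e in v , ⌊⌋-true⁻ (Vec.≡-dec _≟F_ _ w) v↦w

    image-isSubspace : IsSubspace image
    image-isSubspace = subst (λ t → image t ≡ true) (dotsWith-𝟎 L) (∈image⁺ 𝟎ᵛ) , image-⊕ , image-·
      where
      image-⊕ : ∀ x y → image x ≡ true → image y ≡ true → image (x ⊕ᵛ y) ≡ true
      image-⊕ x y x∈ y∈ with ∈image⁻ x x∈ | ∈image⁻ y y∈
      ... | u , refl | v , refl = subst (λ t → image t ≡ true) (dotsWith-⊕ L u v) (∈image⁺ (u ⊕ᵛ v))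
      image-· : ∀ a x → image x ≡ true → image (a ·ᵛ x) ≡ true
      image-· a x x∈ with ∈image⁻ x x∈
      ... | u , refl = subst (λ t → image t ≡ true) (dotsWith-· L a u) (∈image⁺ (a ·ᵛ u))

    module _ (indL : Vectors.LinIndependent n L) where
      perp-image⊆𝟎 : ∀ w → perp image w ≡ true → w ≡ 𝟎ᵛ
      perp-image⊆𝟎 w w⊥ with zero⊎SomeNonzero L w
      ... | inj₁ w≡𝟎 = w≡𝟎
      ... | inj₂ nz  = contradiction (toList w , dot-nondegenerate _ lc⊥ , nz) indL
        where
        lc⊥ : ∀ v → dot (Vectors.lincomb n (toList w) L) v ≡ 0F
        lc⊥ v = trans (dot-comm _ v) (trans (sym (dot-dotsWith L w v))
                  (Orthogonality.perp⇒⊥ d image w w⊥ (dotsWith L v) (∈image⁺ v)))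

      image-full : ∀ w → image w ≡ true
      image-full w = ⊆∧dim≥⇒⊇ image full image-isSubspace (λ _ _ → refl) dim-full≤ w refl
        where
        dim-full≤ : dim full ≤ dim image
        dim-full≤ = subst₂ _≤_ (sym (dim-full d)) (cong (_+ dim image) (⊆𝟎⇒dim≡0 (perp image) perp-image⊆𝟎))
                           (Orthogonality.n≤dim-perp+dim d image)

  dual-witness : ∀ {n} b bs → Vectors.LinIndependent n (b ∷ bs) →
                 ∃ λ v → Orthogonality.annihilator n bs v ≡ true × dot v b ≡ 1F
  dual-witness {n} b bs ind =
    let v , v↦e₀ = DotsWithImage.∈image⁻ (b ∷ bs) e₀ (DotsWithImage.image-full (b ∷ bs) ind e₀)
    in v , Orthogonality.⊥⇒annihilator n v bs (dotsWith≡𝟎⇒⊥ bs v (Vec.∷-injectiveʳ v↦e₀)) , Vec.∷-injectiveˡ v↦e₀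
    where e₀ = 1F ∷ 𝟎ᵛ

  module PerpDimension (n : ℕ) where
    open Vectors n
    open Orthogonality n

    dim-annihilator+length≤n : ∀ bs → LinIndependent bs → dim (annihilator bs) + length bs ≤ n
    dim-annihilator+length≤n []       _   = ≤-reflexive (trans (+-identityʳ _) (dim-full n))
    dim-annihilator+length≤n (b ∷ bs) ind = let v , v∈ , vb≡1 = dual-witness b bs ind in
      begin
        dim (annihilator (b ∷ bs)) + suc (length bs)  ≡⟨ +-suc _ (length bs) ⟩
        suc (dim (annihilator (b ∷ bs))) + length bs  ≤⟨ +-monoˡ-≤ (length bs) (shrinks v v∈ vb≡1) ⟩
        dim (annihilator bs) + length bs              ≤⟨ dim-annihilator+length≤n bs (LinIndependent-tail b bs ind) ⟩
        n                                             ∎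
      where
      open ≤-Reasoning
      shrinks : ∀ v → annihilator bs v ≡ true → dot v b ≡ 1F → dim (annihilator (b ∷ bs)) < dim (annihilator bs)
      shrinks v v∈ vb≡1 = dim-mono-< _ _ (annihilator-isSubspace (b ∷ bs)) (λ _ → ∧-conicalʳ _ _) v v∈
        (cong (_∧ annihilator bs v) (⌊⌋-false⁺ (dot v b ≟F 0F) (λ vb≡0 → 0≢1 (trans (sym vb≡0) vb≡1))))

    dim-perp+dim : ∀ J → dim (perp J) + dim J ≡ n
    dim-perp+dim J = let B , indB , genB = basis J in
      ≤-antisym (subst (_≤ n) (cong₂ _+_ (sym (dim-cong _ _ (perp≗annihilator J B genB))) (sym (dim≡length-basis J B indB genB)))
                           (dim-annihilator+length≤n B indB))
                (n≤dim-perp+dim J)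

    perp-perp : ∀ J → IsSubspace J → perp (perp J) ≗ J
    perp-perp J J-sub v = ⇔true⇒≡ (⊆∧dim≥⇒⊇ J (perp (perp J)) J-sub (⊆perp-perp J) dim≤ v) (⊆perp-perp J v)
      where
      dim≤ : dim (perp (perp J)) ≤ dim J
      dim≤ = ≤-reflexive (+-cancelʳ-≡ (dim (perp J)) _ _
               (trans (dim-perp+dim (perp J)) (trans (sym (dim-perp+dim J)) (+-comm (dim (perp J)) (dim J)))))

  -- Supports of matrices and rank-metric codes

  col : ∀ {n m} → Fin m → Mat n m → Vect n
  col j A = Vec.map (λ row → lookup row j) A

  col-⊕ : ∀ {n m} j (A B : Mat n m) → col j (A ⊕ᴹ B) ≡ col j A ⊕ᵛ col j B
  col-⊕ j []      []      = refl
  col-⊕ j (a ∷ A) (b ∷ B) = cong₂ _∷_ (Vec.lookup-zipWith _+F_ j a b) (col-⊕ j A B)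

  col-· : ∀ {n m} j a (A : Mat n m) → col j (a ·ᴹ A) ≡ a ·ᵛ col j A
  col-· j a []      = refl
  col-· j a (r ∷ A) = cong₂ _∷_ (Vec.lookup-map j (a *F_) r) (col-· j a A)

  col-𝟎 : ∀ {n m} (j : Fin m) → col j (𝟎ᴹ {n}) ≡ 𝟎ᵛ
  col-𝟎 {zero}  j = refl
  col-𝟎 {suc n} j = cong₂ _∷_ (Vec.lookup-replicate j 0F) (col-𝟎 j)

  cols≡𝟎⇒≡𝟎ᴹ : ∀ {n m} (A : Mat n m) → (∀ j → col j A ≡ 𝟎ᵛ) → A ≡ 𝟎ᴹ
  cols≡𝟎⇒≡𝟎ᴹ []      _    = refl
  cols≡𝟎⇒≡𝟎ᴹ (r ∷ A) cols =
    cong₂ _∷_ (row≡𝟎 r (Vec.∷-injectiveˡ ∘ cols)) (cols≡𝟎⇒≡𝟎ᴹ A (Vec.∷-injectiveʳ ∘ cols))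
    where
    row≡𝟎 : ∀ {k} (r : Vect k) → (∀ j → lookup r j ≡ 0F) → r ≡ 𝟎ᵛ
    row≡𝟎 []      _ = refl
    row≡𝟎 (x ∷ r) h = cong₂ _∷_ (h zero) (row≡𝟎 r (h ∘ suc))

  ∈columns⁺ : ∀ {n m} j (A : Mat n m) → col j A ∈ columns A
  ∈columns⁺ j A = subst (col j A ∈_) (sym (toList∘tabulate (λ i → col i A))) (∈-tabulate⁺ j)

  ∈columns⁻ : ∀ {n m} (A : Mat n m) {x} → x ∈ columns A → ∃ λ j → x ≡ col j A
  ∈columns⁻ A x∈ = ∈-tabulate⁻ (subst (_ ∈_) (toList∘tabulate (λ i → col i A)) x∈)

  module Support (n m : ℕ) where
    open Vectors n
    module Mats = Matrices n m

    supportColumns : Mats.Pred → List (Vect n)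
    supportColumns D = concatMap columns (filterᵇ D (vecsOf (vecsOf elems m) n))

    ColumnsIn : Pred → Mat n m → Set
    ColumnsIn J A = ∀ j → J (col j A) ≡ true

    supp⊆⇒ColumnsIn : ∀ J A → (supp A ⊆ᵇ J) ≡ true → ColumnsIn J A
    supp⊆⇒ColumnsIn J A supp⊆J j =
      ⊆ᵇ⇒⊆ (supp A) J supp⊆J (col j A) (Span⇒inSpan _ _ (Span-∈ (columns A) (∈columns⁺ j A)))

    ColumnsIn⇒supp⊆ : ∀ J A → IsSubspace J → ColumnsIn J A → (supp A ⊆ᵇ J) ≡ true
    ColumnsIn⇒supp⊆ J A J-sub cols∈J = ⊆⇒⊆ᵇ (supp A) J λ v v∈ →
      Span⊆subspace J J-sub (columns A)
        (λ x x∈ → let j , x≡ = ∈columns⁻ A x∈ in subst (λ y → J y ≡ true) (sym x≡) (cols∈J j))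
        (inSpan⇒Span (columns A) v v∈)

    restrict-isSubspace : ∀ C → Mats.IsSubspace C → ∀ J → IsSubspace J → Mats.IsSubspace (restrict C J)
    restrict-isSubspace C (C-𝟎 , C-⊕ , C-·) J J-sub@(J-𝟎 , J-⊕ , J-·) =
        ∧-true C-𝟎 (ColumnsIn⇒supp⊆ J 𝟎ᴹ J-sub (λ j → subst (λ x → J x ≡ true) (sym (col-𝟎 j)) J-𝟎))
      , (λ A B A∈ B∈ → ∧-true (C-⊕ A B (∧-conicalˡ _ _ A∈) (∧-conicalˡ _ _ B∈))
           (ColumnsIn⇒supp⊆ J (A ⊕ᴹ B) J-sub (λ j → subst (λ x → J x ≡ true) (sym (col-⊕ j A B))
              (J-⊕ _ _ (supp⊆⇒ColumnsIn J A (∧-conicalʳ _ _ A∈) j) (supp⊆⇒ColumnsIn J B (∧-conicalʳ _ _ B∈) j)))))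
      , (λ a A A∈ → ∧-true (C-· a A (∧-conicalˡ _ _ A∈))
           (ColumnsIn⇒supp⊆ J (a ·ᴹ A) J-sub (λ j → subst (λ x → J x ≡ true) (sym (col-· j a A))
              (J-· a _ (supp⊆⇒ColumnsIn J A (∧-conicalʳ _ _ A∈) j)))))

    restrict⊆ : ∀ C J → Mats._⊆_ (restrict C J) C
    restrict⊆ C J A = ∧-conicalˡ _ _

    restrict-cong : ∀ (C : Mats.Pred) {J J′} → J ≗ J′ → restrict C J ≗ restrict C J′
    restrict-cong C J≗J′ A = cong (C A ∧_) (all-cong (λ v → cong (not (supp A v) ∨_) (J≗J′ v)) (vecsOf elems n))

    restrict-trivial : ∀ C J → (∀ v → J v ≡ true → v ≡ 𝟎ᵛ) → ∀ A → restrict C J A ≡ true → A ≡ 𝟎ᴹ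
    restrict-trivial C J J⊆𝟎 A A∈ = cols≡𝟎⇒≡𝟎ᴹ A (λ j → J⊆𝟎 _ (supp⊆⇒ColumnsIn J A (∧-conicalʳ _ _ A∈) j))

    ⊆restrict-Supp : ∀ C D → Mats._⊆_ D C → Mats._⊆_ D (restrict C (Supp D))
    ⊆restrict-Supp C D D⊆C A A∈D = ∧-true (D⊆C A A∈D)
      (ColumnsIn⇒supp⊆ (Supp D) A (inSpan-isSubspace (supportColumns D)) (λ j → Span⇒inSpan _ _ (Span-∈ (supportColumns D)
        (∈-concatMap⁺ columns (Any.map (λ { refl → ∈columns⁺ j A }) (∈-filterᵇ⁺ D (∈-allMat n m A) A∈D))))))

    Supp⊆ : ∀ C D J → IsSubspace J → Mats._⊆_ D (restrict C J) → Supp D ⊆ J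
    Supp⊆ C D J J-sub D⊆CJ v v∈ = Span⊆subspace J J-sub (supportColumns D) columns∈J (inSpan⇒Span _ v v∈)
      where
      columns∈J : AllIn J (supportColumns D)
      columns∈J x x∈ =
        let A , A∈ , x∈A = find (∈-concatMap⁻ columns {xs = filterᵇ D (vecsOf (vecsOf elems m) n)} x∈)
            j , x≡       = ∈columns⁻ A x∈A
        in subst (λ y → J y ≡ true) (sym x≡)
             (supp⊆⇒ColumnsIn J A (∧-conicalʳ _ _ (D⊆CJ A (∈-filterᵇ⁻ D (vecsOf (vecsOf elems m) n) A∈))) j)

  minimal-dependent-isGirth : ∀ {n} m (ρ : RankFn n) Z → Vectors.IsSubspace n Z → ¬ Independent m ρ Z →
    (∀ Z′ → Vectors.IsSubspace n Z′ → ¬ Independent m ρ Z′ → Vectors.dim n Z ≤ Vectors.dim n Z′) →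
    IsGirth m ρ (Vectors.dim n Z)
  minimal-dependent-isGirth {n} m ρ Z Z-sub Z-dep Z-min =
    (Z , (Z-sub , Z-dep , proper⇒independent) , refl) , (λ Z′ (Z′-sub , Z′-dep , _) → Z-min Z′ Z′-sub Z′-dep)
    where
    open Vectors n
    proper⇒independent : ∀ I → IsSubspace I → I ⊂ Z → Independent m ρ I
    proper⇒independent I I-sub (I⊆Z , v , Zv , Iv) with ρ I ≟ m * dim I
    ... | yes ind = ind
    ... | no  dep = contradiction (Z-min I I-sub dep) (<⇒≱ (dim-mono-< I Z I-sub I⊆Z v Zv Iv))

  module Restriction (n m : ℕ) (C : Matrices.Pred n m) where
    open Vectors n
    open Orthogonality n
    open PerpDimension n
    open Support n m

    dimC : Pred → ℕ
    dimC J = Mats.dim (restrict C J)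

    dimC≤dim : ∀ J → dimC J ≤ Mats.dim C
    dimC≤dim J = Mats.dim-mono _ C (restrict⊆ C J)

    dimC-cong : ∀ {J J′} → J ≗ J′ → dimC J ≡ dimC J′
    dimC-cong J≗J′ = Mats.dim-cong _ _ (restrict-cong C J≗J′)

    dimC-trivial : ∀ J → (∀ v → J v ≡ true → v ≡ 𝟎ᵛ) → dimC J ≡ 0
    dimC-trivial J J⊆𝟎 = Mats.⊆𝟎⇒dim≡0 _ (restrict-trivial C J J⊆𝟎)

    0<dimC⇒0<m*dim : ∀ Z → 0 < dimC Z → 0 < m * dim Z
    0<dimC⇒0<m*dim Z 0<dimCZ = n≢0⇒n>0 (λ m*dim≡0 → <⇒≢ 0<dimCZ (sym (trivial (m*n≡0⇒m≡0∨n≡0 m m*dim≡0))))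
      where
      trivial : m ≡ 0 ⊎ dim Z ≡ 0 → dimC Z ≡ 0
      trivial (inj₁ m≡0)   = Mats.⊆𝟎⇒dim≡0 _ (λ A _ → cols≡𝟎⇒≡𝟎ᴹ A (⊥-elim ∘ ¬Fin0 ∘ subst Fin m≡0))
      trivial (inj₂ dim≡0) = dimC-trivial Z (dim≡0⇒⊆𝟎 Z dim≡0)

    ρC-perp : ∀ J → IsSubspace J → ρC C (perp J) ≡ Mats.dim C ∸ dimC J
    ρC-perp J J-sub = cong (Mats.dim C ∸_) (dimC-cong (perp-perp J J-sub))

    ρC-full : ρC C full ≡ Mats.dim C
    ρC-full = cong (Mats.dim C ∸_) (dimC-trivial _ perp-full⊆𝟎)

  module GeneralizedWeight (n m : ℕ) (C : Matrices.Pred n m) (C-sub : Matrices.IsSubspace n m C)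
                           (r : ℕ) (1≤r : 1 ≤ r) (r≤dim : r ≤ Matrices.dim n m C) where
    open Vectors n
    open Support n m
    open Restriction n m C

    private
      k = Mats.dim C
      t = r ∸ 1

    σ : RankFn n
    σ = dual m (trunc t (ρC C))

    σ-formula : ∀ Z → IsSubspace Z → σ Z ≡ (k ∸ dimC Z) ⊓ (k ∸ t) + m * dim Z ∸ (k ∸ t)
    σ-formula Z Z-sub = begin
      ρC C (perp Z) ⊓ (ρC C full ∸ t) + m * dim Z ∸ ρC C full ⊓ (ρC C full ∸ t)
        ≡⟨ cong₂ (λ a b → a ⊓ (b ∸ t) + m * dim Z ∸ b ⊓ (b ∸ t)) (ρC-perp Z Z-sub) ρC-full ⟩
      (k ∸ dimC Z) ⊓ (k ∸ t) + m * dim Z ∸ k ⊓ (k ∸ t)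
        ≡⟨ cong ((k ∸ dimC Z) ⊓ (k ∸ t) + m * dim Z ∸_) (m≥n⇒m⊓n≡n (m∸n≤m k t)) ⟩
      (k ∸ dimC Z) ⊓ (k ∸ t) + m * dim Z ∸ (k ∸ t)
        ∎
      where open ≡-Reasoning

    dimC<r⇒independent : ∀ Z → IsSubspace Z → dimC Z < r → Independent m σ Z
    dimC<r⇒independent Z Z-sub dimCZ<r =
      trans (σ-formula Z Z-sub) (m≥n⇒m⊓n+o∸n≡o (m * dim Z) (∸-monoʳ-≤ k (<⇒≤∸1 dimCZ<r)))

    r≤dimC⇒dependent : ∀ Z → IsSubspace Z → r ≤ dimC Z → ¬ Independent m σ Z
    r≤dimC⇒dependent Z Z-sub r≤dimCZ ind = <⇒≱ (≤∸1⇒< 1≤r (∸-cancelʳ-≤ (dimC≤dim Z) k∸t≤k∸dimCZ)) r≤dimCZ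
      where
      k∸t≤k∸dimCZ : k ∸ t ≤ k ∸ dimC Z
      k∸t≤k∸dimCZ = m⊓n+o∸n≡o⇒n≤m _ _ (m * dim Z) {{>-nonZero (0<dimC⇒0<m*dim Z (≤-trans 1≤r r≤dimCZ))}}
                      (trans (sym (σ-formula Z Z-sub)) ind)

    dependent⇒r≤dimC : ∀ Z → IsSubspace Z → ¬ Independent m σ Z → r ≤ dimC Z
    dependent⇒r≤dimC Z Z-sub dep with r ≤? dimC Z
    ... | yes r≤dimCZ = r≤dimCZ
    ... | no  r≰dimCZ = contradiction (dimC<r⇒independent Z Z-sub (≰⇒> r≰dimCZ)) dep

    minimal-support : ∃ λ Z → IsSubspace Z × r ≤ dimC Z × (∀ Z′ → IsSubspace Z′ → r ≤ dimC Z′ → dim Z ≤ dim Z′)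
    minimal-support = minimal-subspace (λ J → r ≤ dimC J) (λ J → r ≤? dimC J)
                        (λ J≗J′ → subst (r ≤_) (dimC-cong J≗J′)) full (refl , (λ _ _ _ _ → refl) , (λ _ _ _ → refl))
                        (≤-trans r≤dim (Mats.dim-mono C _ C⊆restrict-full))
      where
      C⊆restrict-full : Mats._⊆_ C (restrict C full)
      C⊆restrict-full A CA = ∧-true CA (⊆⇒⊆ᵇ (supp A) full (λ _ _ → refl))

    minimal-isGenRankWeight : ∀ Z → IsSubspace Z → r ≤ dimC Z →
                              (∀ Z′ → IsSubspace Z′ → r ≤ dimC Z′ → dim Z ≤ dim Z′) → IsGenRankWeight C r (dim Z)
    minimal-isGenRankWeight Z Z-sub r≤dimCZ Z-min =
      let D , D-sub , D⊆CZ , dimD≡r = Mats.subspace-of-dim (restrict C Z) (restrict-isSubspace C C-sub Z Z-sub) r r≤dimCZ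
          D⊆C = λ A A∈ → restrict⊆ C Z A (D⊆CZ A A∈)
      in (D , D-sub , D⊆C , dimD≡r ,
          ≤-antisym (dim-mono (Supp D) Z (Supp⊆ C D Z Z-sub D⊆CZ)) (Z≤Supp D D-sub D⊆C dimD≡r)) ,
         Z≤Supp
      where
      Z≤Supp : ∀ D → Mats.IsSubspace D → Mats._⊆_ D C → Mats.dim D ≡ r → dim Z ≤ dim (Supp D)
      Z≤Supp D _ D⊆C dimD≡r = Z-min (Supp D) (inSpan-isSubspace (supportColumns D))
        (subst (_≤ dimC (Supp D)) dimD≡r (Mats.dim-mono D _ (⊆restrict-Supp C D D⊆C)))

proposition3p16 : (F : FiniteField) (n m : ℕ) (C : Over.M.Pred F n m) →
    Over.M.IsSubspace F n m C →
    (r : ℕ) → 1 ≤ r → r ≤ Over.M.dim F n m C →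
    ∃ λ k → Over.IsGirth F m (Over.dual F m (Over.trunc F (r ∸ 1) (Over.ρC F C))) k
          × Over.IsGenRankWeight F C r k
proposition3p16 F n m C C-sub r 1≤r r≤dim =
  let Z , Z-sub , r≤dimCZ , Z-minimal = minimal-support
  in dim Z ,
     minimal-dependent-isGirth m σ Z Z-sub (r≤dimC⇒dependent Z Z-sub r≤dimCZ)
       (λ Z′ Z′-sub Z′-dep → Z-minimal Z′ Z′-sub (dependent⇒r≤dimC Z′ Z′-sub Z′-dep)) ,
     minimal-isGenRankWeight Z Z-sub r≤dimCZ Z-minimal
  where
  open LinearAlgebra F
  open Vectors n using (dim)
  open GeneralizedWeight n m C C-sub r 1≤r r≤dim
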